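{- Let $k>0$ and $1\le j\le k$. Then in $\mathsf{NSym}$, \[\mathfrak{S}_{(0^{j-1},k)}=(-1)^{j+1}R_{[1^{j-1},k-j+1]}=(-1)^{j+1}\sum_{\beta}\mathfrak{S}_\beta,\] where $(0^{j-1},k)$ is the sequence of $j-1$ zeros followed by $k$, and the sum is over all compositions $\beta$ of $k$ with $\ell(\beta)=j$.
   Context: $\mathsf{NSym}$ is the free associative (non-commutative) algebra over $\mathbb{Q}$ generated by $H_1,H_2,\dots$, with $H_0=1$, $H_i=0$ for $i<0$, and $H_\alpha=H_{\alpha_1}\cdots H_{\alpha_m}$. A composition is a finite sequence of positive integers, $\ell(\beta)$ its number of parts, and $1^i$ denotes $i$ parts equal to $1$. For a composition $\alpha$ of $n$ let $\mathcal{D}(\alpha)=\{\alpha_1,\alpha_1+\alpha_2,\dots,\alpha_1+\dots+\alpha_{m-1}\}$; write $\beta\ge\alpha$ if $\mathcal{D}(\beta)\subseteq\mathcal{D}(\alpha)$. Ribbons: $R_\alpha=\sum_{\beta\ge\alpha}(-1)^{\ell(\alpha)-\ell(\beta)}H_\beta$. For $\alpha\in\mathbb{Z}^m$, $\mathfrak{S}_\alpha=\sum_{\sigma\in S_m}\operatorname{sgn}(\sigma)H_{\alpha_1+\sigma(1)-1,\dots,\alpha_m+\sigma(m)-m}$. -}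

module Defs where

open import Data.Bool using (Bool; true; false; _∧_; _∨_; if_then_else_)
open import Data.Nat as ℕ using (ℕ; zero; suc; _∸_)
open import Data.Integer as ℤ using (ℤ; +_; -[1+_])
open import Data.Rational as ℚ using (ℚ; 0ℚ; 1ℚ)
open import Data.List using (List; []; _∷_; map; concatMap; _++_; foldr; length; filterᵇ; replicate; zipWith; upTo)
open import Data.List.Properties using (≡-dec)
open import Data.Bool.ListAction using (and; or)
open import Data.Maybe using (Maybe; just; nothing)
open import Data.Product using (_×_; _,_)
open import Relation.Nullary.Decidable using (⌊_⌋)
open import Relation.Binary.PropositionalEquality using (_≡_)

-- NSym: an element is a formal ℚ-linear combination of words
-- H_{a₁} ⋯ H_{aₘ} with integer indices aᵢ.  Words are interpreted with
-- H_0 = 1 (zeros are dropped) and H_i = 0 for i < 0 (the whole word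
-- vanishes).  Remaining words are words in the free generators
-- H_1, H_2, …, i.e. lists of positive naturals, which form a basis.

NSym : Set
NSym = List (ℚ × List ℤ)

normWord : List ℤ → Maybe (List ℕ)
normWord [] = just []
normWord (-[1+ _ ] ∷ _) = nothing
normWord (+ zero ∷ w) = normWord w
normWord (+ suc n ∷ w) with normWord w
... | nothing = nothing
... | just v = just (suc n ∷ v)

coeff : NSym → List ℕ → ℚ
coeff [] v = 0ℚ
coeff ((c , w) ∷ x) v with normWord w
... | nothing = coeff x v
... | just u = (if ⌊ ≡-dec ℕ._≟_ u v ⌋ then c else 0ℚ) ℚ.+ coeff x v

infix 4 _≈_
_≈_ : NSym → NSym → Set
x ≈ y = ∀ (v : List ℕ) → coeff x v ≡ coeff y v

scale : ℚ → NSym → NSym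
scale c = map (λ { (d , w) → (c ℚ.* d , w) })

sumN : List NSym → NSym
sumN = foldr _++_ []

Hw : List ℕ → NSym
Hw β = (1ℚ , map +_ β) ∷ []

negOnePow : ℕ → ℚ
negOnePow zero = 1ℚ
negOnePow (suc n) = ℚ.- negOnePow n

incHead : List ℕ → List ℕ
incHead [] = []
incHead (a ∷ r) = suc a ∷ r

compositions : ℕ → List (List ℕ)
compositions zero = [] ∷ []
compositions (suc zero) = (1 ∷ []) ∷ []
compositions (suc (suc n)) =
  map (1 ∷_) (compositions (suc n)) ++ map incHead (compositions (suc n))

descentsFrom : ℕ → List ℕ → List ℕ
descentsFrom s [] = []
descentsFrom s (a ∷ []) = []
descentsFrom s (a ∷ b ∷ r) = (s ℕ.+ a) ∷ descentsFrom (s ℕ.+ a) (b ∷ r)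

𝒟 : List ℕ → List ℕ
𝒟 = descentsFrom 0

memb : ℕ → List ℕ → Bool
memb d xs = or (map (λ x → ⌊ d ℕ.≟ x ⌋) xs)

_≥ᶜ_ : List ℕ → List ℕ → Bool
β ≥ᶜ α = and (map (λ d → memb d (𝒟 α)) (𝒟 β))

sumℕ : List ℕ → ℕ
sumℕ = foldr ℕ._+_ 0

R : List ℕ → NSym
R α = sumN (map (λ β → scale (negOnePow (length α ∸ length β)) (Hw β))
                (filterᵇ (λ β → β ≥ᶜ α) (compositions (sumℕ α))))

insertions : ℕ → List ℕ → List (List ℕ)
insertions x [] = (x ∷ []) ∷ []
insertions x (y ∷ ys) = (x ∷ y ∷ ys) ∷ map (y ∷_) (insertions x ys)

perms : List ℕ → List (List ℕ)
perms [] = [] ∷ []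
perms (x ∷ xs) = concatMap (insertions x) (perms xs)

inversions : List ℕ → ℕ
inversions [] = 0
inversions (x ∷ xs) = length (filterᵇ (λ y → ⌊ y ℕ.<? x ⌋) xs) ℕ.+ inversions xs

sgn : List ℕ → ℚ
sgn σ = negOnePow (inversions σ)

oneTo : ℕ → List ℕ
oneTo m = map suc (upTo m)

𝔖 : List ℤ → NSym
𝔖 α = map (λ σ → (sgn σ , zipWith ℤ._+_ α (zipWith (λ s i → + s ℤ.- + i) σ (oneTo m))))
          (perms (oneTo m))
  where m = length α

-- All three elements are compared coefficientwise, by applying the linear functional χ v that reads off the
-- coefficient of a basis word v, and each is shown to equal (up to the sign (−1)^(j+1)) the value of χ v on the
-- hook ribbon R_(1^(j−1), k−j+1), computed through R_(a,γ) = H_a R_γ − R_(a+γ₁, γ₂, …).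
--
-- 𝔖_α is the determinant of [H_(α_i + c − i)] with the factors of each term multiplied in row order; expanded along
-- column 0 it is linear in every row and column and vanishes when two columns coincide.  For α = (0^(j−1), k) the
-- first column holds H_0 = 1, negative letters and H_(k−j+1), and the expansion reproduces the ribbon recursion.
-- The ribbon itself satisfies that recursion because a composition starts either with a part 1 or with a larger
-- part.  For the sum of the 𝔖_β, row linearity collects the β in a box {1, …, N}^j into one determinant whose
-- entries are runs H_s + ⋯ + H_(s+N−1); subtracting neighbouring columns telescopes each run to its two ends, the
-- far ends lie above the degree k and vanish, and what is left is once more the ribbon recursion.

module Submission where

open import Defs
open import Data.Nat as ℕ using (ℕ; zero; suc; z≤n; s≤s; _<_; _≤_; _∸_)
import Data.Nat.Properties as ℕ
open import Data.Integer as ℤ using (ℤ; +_; -[1+_]; 0ℤ)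
import Data.Integer.Properties as ℤ
import Data.Integer.Solver as ℤ-Solver
open import Data.Rational using (ℚ; 0ℚ; 1ℚ; ½; _+_; _-_; _*_; -_)
import Data.Rational.Properties as ℚ
open import Data.Rational.Solver using (module +-*-Solver)
open import Data.List using (List; []; _∷_; _++_; map; concatMap; filterᵇ; foldr; length; replicate; upTo; applyUpTo; zipWith)
import Data.List.Properties as List
open import Data.List.Relation.Unary.All as All using (All; []; _∷_)
open import Data.List.Relation.Unary.All.Properties as All using (¬Any⇒All¬)
open import Data.List.Relation.Unary.Any using (Any; here; there; any?)
open import Data.List.Relation.Unary.Any.Properties using (++⁺ˡ)
open import Data.Maybe using (Maybe; just; nothing)
open import Data.Bool using (Bool; true; false; _∧_; _∨_; if_then_else_)
open import Data.Bool.ListAction using (and)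
open import Data.Product using (_×_; ∃; _,_; proj₁; proj₂)
open import Data.Empty using (⊥-elim)
open import Function using (id; _∘_; _∘′_; _⇔_; mk⇔)
open import Algebra.Properties.Group ℚ.+-0-group using (⁻¹-involutive)
open import Algebra.Properties.AbelianGroup ℤ.+-0-abelianGroup using () renaming (∙-cancelˡ to +-cancelˡ)
open import Relation.Nullary using (Dec; yes; no; ¬_)
open import Relation.Nullary.Decidable using (⌊_⌋; isYes≗does; does-⇔; dec-false)
open import Relation.Binary.Definitions using (tri<; tri≈; tri>)
open import Relation.Binary.PropositionalEquality
open ≡-Reasoning

private
  variable
    A B : Set

⌊⌋-⇔ : A ⇔ B → (a? : Dec A) (b? : Dec B) → ⌊ a? ⌋ ≡ ⌊ b? ⌋
⌊⌋-⇔ A⇔B a? b? = trans (isYes≗does a?) (trans (does-⇔ A⇔B a? b?) (sym (isYes≗does b?)))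

⌊⌋-false : (a? : Dec A) → ¬ A → ⌊ a? ⌋ ≡ false
⌊⌋-false a? ¬a = trans (isYes≗does a?) (dec-false a? ¬a)

negOnePow-+ : ∀ m n → negOnePow (m ℕ.+ n) ≡ negOnePow m * negOnePow n
negOnePow-+ zero    n = sym (ℚ.*-identityˡ (negOnePow n))
negOnePow-+ (suc m) n = trans (cong -_ (negOnePow-+ m n)) (ℚ.neg-distribˡ-* (negOnePow m) (negOnePow n))

-- the one step that needs 2 to be invertible
neg-fixed⇒0 : ∀ a → a ≡ - a → a ≡ 0ℚ
neg-fixed⇒0 a a≡-a = begin
  a            ≡⟨ solve 1 (λ a → a := con ½ :* (a :+ a)) refl a ⟩
  ½ * (a + a)  ≡⟨ cong (λ b → ½ * (a + b)) a≡-a ⟩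
  ½ * (a - a)  ≡⟨ solve 1 (λ a → con ½ :* (a :- a) := con 0ℚ) refl a ⟩
  0ℚ           ∎
  where open +-*-Solver

[1+m]-[1+n]≡m-n : ∀ m n → + suc m ℤ.- + suc n ≡ + m ℤ.- + n
[1+m]-[1+n]≡m-n m n = trans (ℤ.m-n≡m⊖n (suc m) (suc n)) (trans (ℤ.[1+m]⊖[1+n]≡m⊖n m n) (sym (ℤ.m-n≡m⊖n m n)))

suc-[m-n] : ∀ m n → ℤ.suc (+ m ℤ.- + n) ≡ + suc m ℤ.- + n
suc-[m-n] m n = solve 2 (λ m n → con (+ 1) :+ (m :- n) := (con (+ 1) :+ m) :- n) refl (+ m) (+ n)
  where open ℤ-Solver.+-*-Solver

if-≟-then : ∀ n K {x : ℚ} → (n ≢ K → x ≡ 0ℚ) → (if ⌊ n ℕ.≟ K ⌋ then x else 0ℚ) ≡ x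
if-≟-then n K x≡0 with n ℕ.≟ K
... | yes _   = refl
... | no  n≢K = sym (x≡0 n≢K)

if-≟-else : ∀ n K {x : ℚ} → (n ≡ K → x ≡ 0ℚ) → (if ⌊ n ℕ.≟ K ⌋ then x else 0ℚ) ≡ 0ℚ
if-≟-else n K x≡0 with n ℕ.≟ K
... | yes n≡K = x≡0 n≡K
... | no  _   = refl

+-interchange : ∀ a b c d → (a + b) + (c + d) ≡ (a + c) + (b + d)
+-interchange = solve 4 (λ a b c d → (a :+ b) :+ (c :+ d) := (a :+ c) :+ (b :+ d)) refl
  where open +-*-Solver

sumTo : ℕ → (ℕ → ℚ) → ℚ
sumTo zero    h = 0ℚ
sumTo (suc n) h = h 0 + sumTo n (λ i → h (suc i))

sumTo-cong : ∀ n {h h′ : ℕ → ℚ} → (∀ i → i < n → h i ≡ h′ i) → sumTo n h ≡ sumTo n h′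
sumTo-cong zero    eq = refl
sumTo-cong (suc n) eq = cong₂ _+_ (eq 0 (s≤s z≤n)) (sumTo-cong n (λ i i<n → eq (suc i) (s≤s i<n)))

sumTo-distrib : ∀ n (h h′ : ℕ → ℚ) → sumTo n (λ i → h i + h′ i) ≡ sumTo n h + sumTo n h′
sumTo-distrib zero    h h′ = refl
sumTo-distrib (suc n) h h′ =
  trans (cong (_+_ (h 0 + h′ 0)) (sumTo-distrib n _ _)) (+-interchange (h 0) (h′ 0) _ _)

sumTo-*ˡ : ∀ n c (h : ℕ → ℚ) → sumTo n (λ i → c * h i) ≡ c * sumTo n h
sumTo-*ˡ zero    c h = sym (ℚ.*-zeroʳ c)
sumTo-*ˡ (suc n) c h = trans (cong (_+_ (c * h 0)) (sumTo-*ˡ n c _)) (sym (ℚ.*-distribˡ-+ c _ _))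

sumTo-neg : ∀ n (h : ℕ → ℚ) → sumTo n (λ i → - h i) ≡ - sumTo n h
sumTo-neg zero    h = refl
sumTo-neg (suc n) h = trans (cong (_+_ (- h 0)) (sumTo-neg n _)) (sym (ℚ.neg-distrib-+ (h 0) _))

sumTo-zero : ∀ n {h : ℕ → ℚ} → (∀ i → i < n → h i ≡ 0ℚ) → sumTo n h ≡ 0ℚ
sumTo-zero zero    eq = refl
sumTo-zero (suc n) eq =
  trans (cong₂ _+_ (eq 0 (s≤s z≤n)) (sumTo-zero n (λ i i<n → eq (suc i) (s≤s i<n)))) (ℚ.+-identityˡ 0ℚ)

sumTo-swap : ∀ m n (h : ℕ → ℕ → ℚ) →
  sumTo m (λ i → sumTo n (h i)) ≡ sumTo n (λ j → sumTo m (λ i → h i j))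
sumTo-swap zero    n h = sym (sumTo-zero n (λ _ _ → refl))
sumTo-swap (suc m) n h =
  trans (cong (_+_ (sumTo n (h 0))) (sumTo-swap m n _)) (sym (sumTo-distrib n _ _))

sumTo-last : ∀ n (h : ℕ → ℚ) → sumTo (suc n) h ≡ sumTo n h + h n
sumTo-last zero    h = trans (ℚ.+-identityʳ (h 0)) (sym (ℚ.+-identityˡ (h 0)))
sumTo-last (suc n) h = trans (cong (_+_ (h 0)) (sumTo-last n (λ i → h (suc i)))) (sym (ℚ.+-assoc (h 0) _ _))

sumTo-telescope : ∀ n (h : ℕ → ℚ) → sumTo n (λ b → h b - h (suc b)) ≡ h 0 - h n
sumTo-telescope zero    h = solve 1 (λ x → con 0ℚ := x :- x) refl (h 0)
  where open +-*-Solver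
sumTo-telescope (suc n) h = begin
  (h 0 - h 1) + sumTo n (λ b → h (suc b) - h (suc (suc b)))
    ≡⟨ cong (_+_ (h 0 - h 1)) (sumTo-telescope n (λ b → h (suc b))) ⟩
  (h 0 - h 1) + (h 1 - h (suc n))
    ≡⟨ solve 3 (λ x y z → (x :- y) :+ (y :- z) := x :- z) refl (h 0) (h 1) (h (suc n)) ⟩
  h 0 - h (suc n) ∎
  where open +-*-Solver

sumTo-extend : ∀ m n (h : ℕ → ℚ) → m ≤ n → (∀ i → m ≤ i → i < n → h i ≡ 0ℚ) → sumTo m h ≡ sumTo n h
sumTo-extend zero    n       h _         h≡0 = sym (sumTo-zero n (λ i i<n → h≡0 i z≤n i<n))
sumTo-extend (suc m) (suc n) h (s≤s m≤n) h≡0 =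
  cong (_+_ (h 0)) (sumTo-extend m n (λ i → h (suc i)) m≤n (λ i m≤i i<n → h≡0 (suc i) (s≤s m≤i) (s≤s i<n)))

sumOver : List A → (A → ℚ) → ℚ
sumOver []       g = 0ℚ
sumOver (x ∷ xs) g = g x + sumOver xs g

sumOver-cong : ∀ (xs : List A) {g g′ : A → ℚ} → (∀ x → g x ≡ g′ x) → sumOver xs g ≡ sumOver xs g′
sumOver-cong []       eq = refl
sumOver-cong (x ∷ xs) eq = cong₂ _+_ (eq x) (sumOver-cong xs eq)

sumOver-congᴬ : ∀ {P : A → Set} {xs : List A} {g g′ : A → ℚ} →
  All P xs → (∀ x → P x → g x ≡ g′ x) → sumOver xs g ≡ sumOver xs g′
sumOver-congᴬ []         eq = refl
sumOver-congᴬ (px ∷ pxs) eq = cong₂ _+_ (eq _ px) (sumOver-congᴬ pxs eq)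

sumOver-distrib : ∀ (xs : List A) (g g′ : A → ℚ) →
  sumOver xs (λ x → g x + g′ x) ≡ sumOver xs g + sumOver xs g′
sumOver-distrib []       g g′ = refl
sumOver-distrib (x ∷ xs) g g′ =
  trans (cong (_+_ (g x + g′ x)) (sumOver-distrib xs g g′)) (+-interchange (g x) (g′ x) _ _)

sumOver-*ˡ : ∀ (xs : List A) c (g : A → ℚ) → sumOver xs (λ x → c * g x) ≡ c * sumOver xs g
sumOver-*ˡ []       c g = sym (ℚ.*-zeroʳ c)
sumOver-*ˡ (x ∷ xs) c g = trans (cong (_+_ (c * g x)) (sumOver-*ˡ xs c g)) (sym (ℚ.*-distribˡ-+ c _ _))

sumOver-neg : ∀ (xs : List A) (g : A → ℚ) → sumOver xs (λ x → - g x) ≡ - sumOver xs g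
sumOver-neg []       g = refl
sumOver-neg (x ∷ xs) g = trans (cong (_+_ (- g x)) (sumOver-neg xs g)) (sym (ℚ.neg-distrib-+ (g x) _))

sumOver-zero : ∀ (xs : List A) {g : A → ℚ} → (∀ x → g x ≡ 0ℚ) → sumOver xs g ≡ 0ℚ
sumOver-zero []       eq = refl
sumOver-zero (x ∷ xs) eq = trans (cong₂ _+_ (eq x) (sumOver-zero xs eq)) (ℚ.+-identityˡ 0ℚ)

sumOver-++ : ∀ (xs ys : List A) (g : A → ℚ) → sumOver (xs ++ ys) g ≡ sumOver xs g + sumOver ys g
sumOver-++ []       ys g = sym (ℚ.+-identityˡ _)
sumOver-++ (x ∷ xs) ys g = trans (cong (_+_ (g x)) (sumOver-++ xs ys g)) (sym (ℚ.+-assoc (g x) _ _))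

sumOver-map : ∀ (t : A → B) (xs : List A) (g : B → ℚ) → sumOver (map t xs) g ≡ sumOver xs (λ x → g (t x))
sumOver-map t []       g = refl
sumOver-map t (x ∷ xs) g = cong (_+_ (g (t x))) (sumOver-map t xs g)

sumOver-concatMap : ∀ (t : A → List B) (xs : List A) (g : B → ℚ) →
  sumOver (concatMap t xs) g ≡ sumOver xs (λ x → sumOver (t x) g)
sumOver-concatMap t []       g = refl
sumOver-concatMap t (x ∷ xs) g =
  trans (sumOver-++ (t x) (concatMap t xs) g) (cong (_+_ (sumOver (t x) g)) (sumOver-concatMap t xs g))

sumOver-filter : ∀ (P : A → Bool) (xs : List A) (g : A → ℚ) →
  sumOver (filterᵇ P xs) g ≡ sumOver xs (λ x → if P x then g x else 0ℚ)
sumOver-filter P []       g = refl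
sumOver-filter P (x ∷ xs) g with P x
... | true  = cong (_+_ (g x)) (sumOver-filter P xs g)
... | false = trans (sumOver-filter P xs g) (sym (ℚ.+-identityˡ _))

sumOver-sumTo : ∀ (xs : List A) n (g : A → ℕ → ℚ) →
  sumOver xs (λ x → sumTo n (g x)) ≡ sumTo n (λ i → sumOver xs (λ x → g x i))
sumOver-sumTo []       n g = sym (sumTo-zero n (λ _ _ → refl))
sumOver-sumTo (x ∷ xs) n g =
  trans (cong (_+_ (sumTo n (g x))) (sumOver-sumTo xs n g)) (sym (sumTo-distrib n _ _))

insertAt : ℕ → A → List A → List A
insertAt zero    x w       = x ∷ w
insertAt (suc p) x []      = x ∷ []
insertAt (suc p) x (y ∷ w) = y ∷ insertAt p x w

length-insertAt : ∀ p (x : A) w → length (insertAt p x w) ≡ suc (length w)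
length-insertAt zero    x w       = refl
length-insertAt (suc p) x []      = refl
length-insertAt (suc p) x (y ∷ w) = cong suc (length-insertAt p x w)

insertAt-insertAt : ∀ p q (x y : A) w → p ≤ q → p ≤ length w →
  insertAt p x (insertAt q y w) ≡ insertAt (suc q) y (insertAt p x w)
insertAt-insertAt zero    q       x y w       _         _         = refl
insertAt-insertAt (suc p) (suc q) x y (z ∷ w) (s≤s p≤q) (s≤s p≤w) = cong (z ∷_) (insertAt-insertAt p q x y w p≤q p≤w)

insertAt-++ : ∀ p (y : A) w s → p ≤ length w → insertAt p y w ++ s ≡ insertAt p y (w ++ s)
insertAt-++ zero    y w       s _         = refl
insertAt-++ (suc p) y (z ∷ w) s (s≤s p≤w) = cong (z ∷_) (insertAt-++ p y w s p≤w)

insertAt-beyond : ∀ p (y : A) w → length w ≤ p → insertAt p y w ≡ w ++ y ∷ []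
insertAt-beyond zero    y []      _         = refl
insertAt-beyond (suc p) y []      _         = refl
insertAt-beyond (suc p) y (z ∷ w) (s≤s w≤p) = cong (z ∷_) (insertAt-beyond p y w w≤p)

insertAt-length : ∀ (y : A) w s → insertAt (length w) y (w ++ s) ≡ w ++ y ∷ s
insertAt-length y []      s = refl
insertAt-length y (z ∷ w) s = cong (z ∷_) (insertAt-length y w s)

punchIn : ℕ → ℕ → ℕ
punchIn zero    i       = suc i
punchIn (suc p) zero    = zero
punchIn (suc p) (suc i) = suc (punchIn p i)

punchIn-< : ∀ {m} p i → p < suc m → i < m → punchIn p i < suc m
punchIn-< zero    i       _         i<m       = s≤s i<m
punchIn-< (suc p) zero    _         (s≤s _)   = s≤s z≤n
punchIn-< (suc p) (suc i) (s≤s p<m) (s≤s i<m) = s≤s (punchIn-< p i p<m i<m)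

punchOut : ℕ → ℕ → ℕ
punchOut zero    zero    = zero
punchOut zero    (suc r) = r
punchOut (suc p) zero    = zero
punchOut (suc p) (suc r) = suc (punchOut p r)

punchOut-punchIn : ∀ p q → punchOut p (punchIn p q) ≡ q
punchOut-punchIn zero    q       = refl
punchOut-punchIn (suc p) zero    = refl
punchOut-punchIn (suc p) (suc q) = cong suc (punchOut-punchIn p q)

punchIn-punchOut : ∀ p r → p ≢ r → punchIn p (punchOut p r) ≡ r
punchIn-punchOut zero    zero    p≢r = ⊥-elim (p≢r refl)
punchIn-punchOut zero    (suc r) p≢r = refl
punchIn-punchOut (suc p) zero    p≢r = refl
punchIn-punchOut (suc p) (suc r) p≢r = cong suc (punchIn-punchOut p r (p≢r ∘′ cong suc))

punchInᵢ≢i : ∀ p q → punchIn p q ≢ p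
punchInᵢ≢i zero    q       ()
punchInᵢ≢i (suc p) zero    ()
punchInᵢ≢i (suc p) (suc q) eq = punchInᵢ≢i p q (ℕ.suc-injective eq)

punchIn-≤ : ∀ p q → p ≤ q → punchIn p q ≡ suc q
punchIn-≤ zero    q       _         = refl
punchIn-≤ (suc p) (suc q) (s≤s p≤q) = cong suc (punchIn-≤ p q p≤q)

punchIn-> : ∀ q p → p ≤ q → punchIn (suc q) p ≡ p
punchIn-> q       zero    _         = refl
punchIn-> (suc q) (suc p) (s≤s p≤q) = cong suc (punchIn-> q p p≤q)

punchOut-≤ : ∀ p q → p ≤ q → punchOut p (suc q) ≡ q
punchOut-≤ p q p≤q = trans (cong (punchOut p) (sym (punchIn-≤ p q p≤q))) (punchOut-punchIn p q)

punchOut-> : ∀ q p → p ≤ q → punchOut (suc q) p ≡ p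
punchOut-> q p p≤q = trans (cong (punchOut (suc q)) (sym (punchIn-> q p p≤q))) (punchOut-punchIn (suc q) p)

punchIn-punchIn : ∀ p q i → p ≤ q → punchIn p (punchIn q i) ≡ punchIn (suc q) (punchIn p i)
punchIn-punchIn zero    q       i       _         = refl
punchIn-punchIn (suc p) (suc q) zero    _         = refl
punchIn-punchIn (suc p) (suc q) (suc i) (s≤s p≤q) = cong suc (punchIn-punchIn p q i p≤q)

punchIn-injective : ∀ p i j → punchIn p i ≡ punchIn p j → i ≡ j
punchIn-injective zero    i       j       eq = ℕ.suc-injective eq
punchIn-injective (suc p) zero    zero    eq = refl
punchIn-injective (suc p) (suc i) (suc j) eq = cong suc (punchIn-injective p i j (ℕ.suc-injective eq))

punchOut-< : ∀ m p r → p < suc m → r < suc m → p ≢ r → punchOut p r < m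
punchOut-< m       zero    zero    _         _         p≢r = ⊥-elim (p≢r refl)
punchOut-< m       zero    (suc r) _         (s≤s r<m) _   = r<m
punchOut-< zero    (suc p) r       (s≤s ())  _         _
punchOut-< (suc m) (suc p) zero    _         _         _   = s≤s z≤n
punchOut-< (suc m) (suc p) (suc r) (s≤s p<m) (s≤s r<m) p≢r = s≤s (punchOut-< m p r p<m r<m (p≢r ∘′ cong suc))

sumTo-punchIn : ∀ n p (h : ℕ → ℚ) → p < suc n → sumTo (suc n) h ≡ h p + sumTo n (λ i → h (punchIn p i))
sumTo-punchIn n       zero    h _         = refl
sumTo-punchIn (suc n) (suc p) h (s≤s p<n) = begin
  h 0 + sumTo (suc n) (λ i → h (suc i))                ≡⟨ cong (_+_ (h 0)) (sumTo-punchIn n p (λ i → h (suc i)) p<n) ⟩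
  h 0 + (h (suc p) + rest)                              ≡⟨ +-lcomm (h 0) (h (suc p)) rest ⟩
  h (suc p) + (h 0 + rest)                              ∎
  where
  rest = sumTo n (λ i → h (suc (punchIn p i)))
  +-lcomm : ∀ a b c → a + (b + c) ≡ b + (a + c)
  +-lcomm = solve 3 (λ a b c → a :+ (b :+ c) := b :+ (a :+ c)) refl
    where open +-*-Solver

sumTo-single : ∀ n i (h : ℕ → ℚ) → i < n → (∀ b → b ≢ i → h b ≡ 0ℚ) → sumTo n h ≡ h i
sumTo-single (suc n) i h i<n h≡0 = begin
  sumTo (suc n) h                         ≡⟨ sumTo-punchIn n i h i<n ⟩
  h i + sumTo n (λ b → h (punchIn i b))   ≡⟨ cong (_+_ (h i)) (sumTo-zero n (λ b _ → h≡0 (punchIn i b) (punchInᵢ≢i i b))) ⟩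
  h i + 0ℚ                                ≡⟨ ℚ.+-identityʳ (h i) ⟩
  h i                                     ∎

lookupOr : A → List A → ℕ → A
lookupOr d []       i       = d
lookupOr d (a ∷ as) zero    = a
lookupOr d (a ∷ as) (suc i) = lookupOr d as i

lookupOr-map : ∀ (g : A → B) d as i → lookupOr (g d) (map g as) i ≡ g (lookupOr d as i)
lookupOr-map g d []       i       = refl
lookupOr-map g d (a ∷ as) zero    = refl
lookupOr-map g d (a ∷ as) (suc i) = lookupOr-map g d as i

lookupOr-oneTo : ∀ {m} i → i < m → lookupOr 0 (oneTo m) i ≡ suc i
lookupOr-oneTo = go id
  where
  go : ∀ (g : ℕ → ℕ) {m} i → i < m → lookupOr 0 (map suc (applyUpTo g m)) i ≡ suc (g i)
  go g {suc m} zero    _         = refl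
  go g {suc m} (suc i) (s≤s i<m) = go (λ x → g (suc x)) i i<m

Combo : Set → Set
Combo A = List (ℚ × A)

pair : Combo A → (A → ℚ) → ℚ
pair x g = sumOver x (λ t → proj₁ t * g (proj₂ t))

pair-cong : ∀ (x : Combo A) {g g′ : A → ℚ} → (∀ a → g a ≡ g′ a) → pair x g ≡ pair x g′
pair-cong x eq = sumOver-cong x (λ t → cong (proj₁ t *_) (eq (proj₂ t)))

pair-distrib : ∀ (x : Combo A) (g g′ : A → ℚ) → pair x (λ a → g a + g′ a) ≡ pair x g + pair x g′
pair-distrib x g g′ =
  trans (sumOver-cong x (λ t → ℚ.*-distribˡ-+ (proj₁ t) _ _)) (sumOver-distrib x _ _)

pair-*ˡ : ∀ (x : Combo A) c (g : A → ℚ) → pair x (λ a → c * g a) ≡ c * pair x g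
pair-*ˡ x c g = trans (sumOver-cong x (λ t → *-lcomm (proj₁ t) c (g (proj₂ t)))) (sumOver-*ˡ x c _)
  where
  *-lcomm : ∀ a b c → a * (b * c) ≡ b * (a * c)
  *-lcomm = solve 3 (λ a b c → a :* (b :* c) := b :* (a :* c)) refl
    where open +-*-Solver

pair-zero : ∀ (x : Combo A) {g : A → ℚ} → (∀ a → g a ≡ 0ℚ) → pair x g ≡ 0ℚ
pair-zero x eq = sumOver-zero x (λ t → trans (cong (proj₁ t *_) (eq (proj₂ t))) (ℚ.*-zeroʳ (proj₁ t)))

pair-++ : ∀ (x y : Combo A) (g : A → ℚ) → pair (x ++ y) g ≡ pair x g + pair y g
pair-++ x y g = sumOver-++ x y _

pair-swap : ∀ (x : Combo A) (y : Combo B) (g : A → B → ℚ) →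
  pair x (λ a → pair y (g a)) ≡ pair y (λ b → pair x (λ a → g a b))
pair-swap []            y g = sym (pair-zero y (λ _ → refl))
pair-swap ((c , a) ∷ x) y g =
  trans (cong₂ _+_ (sym (pair-*ˡ y c (g a))) (pair-swap x y g)) (sym (pair-distrib y _ _))

pair-sumTo : ∀ (x : Combo A) n (g : A → ℕ → ℚ) → pair x (λ a → sumTo n (g a)) ≡ sumTo n (λ i → pair x (λ a → g a i))
pair-sumTo x n g = trans (sumOver-cong x (λ t → sym (sumTo-*ˡ n (proj₁ t) (g (proj₂ t))))) (sumOver-sumTo x n _)

infix 4 _≐_
_≐_ : Combo A → Combo A → Set
x ≐ y = ∀ g → pair x g ≡ pair y g

negCombo : Combo A → Combo A
negCombo = map (λ t → - proj₁ t , proj₂ t)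

pair-negCombo : ∀ (x : Combo A) g → pair (negCombo x) g ≡ - pair x g
pair-negCombo x g = begin
  pair (negCombo x) g                       ≡⟨ sumOver-map _ x _ ⟩
  sumOver x (λ t → - proj₁ t * g (proj₂ t)) ≡⟨ sumOver-cong x (λ t → ℚ.neg-distribˡ-* (proj₁ t) _) ⟨
  sumOver x (λ t → - (proj₁ t * g (proj₂ t))) ≡⟨ sumOver-neg x _ ⟩
  - pair x g                                ∎

pair-++-negCombo : ∀ (x y : Combo A) g → pair (x ++ negCombo y) g ≡ pair x g - pair y g
pair-++-negCombo x y g = trans (pair-++ x (negCombo y) g) (cong (_+_ (pair x g)) (pair-negCombo y g))

concatTo : ℕ → (ℕ → Combo A) → Combo A
concatTo zero    e = []
concatTo (suc n) e = e 0 ++ concatTo n (λ b → e (suc b))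

pair-concatTo : ∀ n (e : ℕ → Combo A) g → pair (concatTo n e) g ≡ sumTo n (λ b → pair (e b) g)
pair-concatTo zero    e g = refl
pair-concatTo (suc n) e g = trans (pair-++ (e 0) _ g) (cong (_+_ (pair (e 0) g)) (pair-concatTo n _ g))

letter : ℤ → Combo ℤ
letter x = (1ℚ , x) ∷ []

letter-cong : ∀ {x y : ℤ} → x ≡ y → letter x ≐ letter y
letter-cong refl g = refl

pair-letter : ∀ x (g : ℤ → ℚ) → pair (letter x) g ≡ g x
pair-letter x g = trans (ℚ.+-identityʳ _) (ℚ.*-identityˡ (g x))

pair-scale : ∀ c (x : NSym) f → pair (scale c x) f ≡ c * pair x f
pair-scale c []            f = sym (ℚ.*-zeroʳ c)
pair-scale c ((d , w) ∷ x) f = trans (cong₂ _+_ (ℚ.*-assoc c d (f w)) (pair-scale c x f)) (sym (ℚ.*-distribˡ-+ c _ _))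

pair-sumN : ∀ (xs : List NSym) f → pair (sumN xs) f ≡ sumOver xs (λ x → pair x f)
pair-sumN []       f = refl
pair-sumN (x ∷ xs) f = trans (pair-++ x (sumN xs) f) (cong (_+_ (pair x f)) (pair-sumN xs f))

pair-Hw : ∀ β f → pair (Hw β) f ≡ f (map +_ β)
pair-Hw β f = trans (ℚ.+-identityʳ _) (ℚ.*-identityˡ _)

-- Noncommutative determinants

Matrix : Set
Matrix = ℕ → ℕ → Combo ℤ

minor : ℕ → Matrix → Matrix
minor p M i c = M (punchIn p i) (suc c)

-- det m M f is f, extended linearly, applied to the m × m determinant Σ_σ sgn σ M₀σ₀ ⋯ M₍ₘ₋₁₎σ₍ₘ₋₁₎ whose
-- factors are multiplied in row order; expanding along column 0 puts the letter from row p at position p.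
det : ℕ → Matrix → (List ℤ → ℚ) → ℚ
det zero    M f = f []
det (suc m) M f =
  sumTo (suc m) (λ p → negOnePow p * pair (M p 0) (λ x → det m (minor p M) (λ w → f (insertAt p x w))))

det-cong : ∀ m {M M′ : Matrix} {f f′ : List ℤ → ℚ} →
  (∀ i c → i < m → M i c ≐ M′ i c) → (∀ w → length w ≡ m → f w ≡ f′ w) → det m M f ≡ det m M′ f′
det-cong zero    eqM eqf = eqf [] refl
det-cong (suc m) {M} {M′} {f} {f′} eqM eqf = sumTo-cong (suc m) λ p p<m → cong (negOnePow p *_)
  (trans (pair-cong (M p 0) (λ x → det-cong m {minor p M} {minor p M′}
                                     (λ i c i<m → eqM (punchIn p i) (suc c) (punchIn-< p i p<m i<m))
                                     (λ w ∣w∣ → eqf (insertAt p x w) (trans (length-insertAt p x w) (cong suc ∣w∣)))))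
         (eqM p 0 p<m _))

det-zero : ∀ m (M : Matrix) (f : List ℤ → ℚ) → (∀ w → length w ≡ m → f w ≡ 0ℚ) → det m M f ≡ 0ℚ
det-zero zero    M f eqf = eqf [] refl
det-zero (suc m) M f eqf = sumTo-zero (suc m) λ p _ →
  trans (cong (negOnePow p *_) (pair-zero (M p 0) (λ x →
          det-zero m (minor p M) _ (λ w ∣w∣ → eqf (insertAt p x w) (trans (length-insertAt p x w) (cong suc ∣w∣))))))
        (ℚ.*-zeroʳ (negOnePow p))

letterMatrix : (ℕ → ℕ → ℤ) → Matrix
letterMatrix L i c = letter (L i c)

det₁-letterMatrix : ∀ L (f : List ℤ → ℚ) → det 1 (letterMatrix L) f ≡ f (L 0 0 ∷ [])
det₁-letterMatrix L f =
  trans (ℚ.+-identityʳ _) (trans (ℚ.*-identityˡ _) (pair-letter (L 0 0) (λ x → f (x ∷ []))))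

module _ (m : ℕ) (M : Matrix) (f : List ℤ → ℚ) where

  -- the part of det (2 + m) M f in which column 0 takes row p and column 1 takes row punchIn p q
  expand₂ : ℕ → ℕ → ℚ
  expand₂ p q = negOnePow p * (negOnePow q * pair (M p 0) (λ x → pair (M (punchIn p q) 1) (λ y →
    det m (minor q (minor p M)) (λ w → f (insertAt p x (insertAt q y w))))))

  det-expand₂ : det (suc (suc m)) M f ≡ sumTo (suc (suc m)) (λ p → sumTo (suc m) (expand₂ p))
  det-expand₂ = sumTo-cong (suc (suc m)) λ p _ → begin
    negOnePow p * pair (M p 0) (λ x → sumTo (suc m) (λ q → negOnePow q * inner p q x))
      ≡⟨ cong (negOnePow p *_) (pair-sumTo (M p 0) (suc m) (λ x q → negOnePow q * inner p q x)) ⟩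
    negOnePow p * sumTo (suc m) (λ q → pair (M p 0) (λ x → negOnePow q * inner p q x))
      ≡⟨ cong (negOnePow p *_) (sumTo-cong (suc m) (λ q _ → pair-*ˡ (M p 0) (negOnePow q) (inner p q))) ⟩
    negOnePow p * sumTo (suc m) (λ q → negOnePow q * pair (M p 0) (inner p q))
      ≡⟨ sumTo-*ˡ (suc m) (negOnePow p) (λ q → negOnePow q * pair (M p 0) (inner p q)) ⟨
    sumTo (suc m) (expand₂ p) ∎
    where
    inner : ℕ → ℕ → ℤ → ℚ
    inner p q x = pair (M (punchIn p q) 1) (λ y → det m (minor q (minor p M)) (λ w → f (insertAt p x (insertAt q y w))))

  expand₂′ : ℕ → ℕ → ℚ
  expand₂′ p r with p ℕ.≟ r
  ... | yes _ = 0ℚ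
  ... | no  _ = expand₂ p (punchOut p r)

  expand₂′-punchIn : ∀ p q → expand₂′ p (punchIn p q) ≡ expand₂ p q
  expand₂′-punchIn p q with p ℕ.≟ punchIn p q
  ... | yes p≡ = ⊥-elim (punchInᵢ≢i p q (sym p≡))
  ... | no  _  = cong (expand₂ p) (punchOut-punchIn p q)

  expand₂′-diagonal : ∀ p → expand₂′ p p ≡ 0ℚ
  expand₂′-diagonal p with p ℕ.≟ p
  ... | yes _  = refl
  ... | no p≢p = ⊥-elim (p≢p refl)

  sumTo-expand₂′ : det (suc (suc m)) M f ≡ sumTo (suc (suc m)) (λ p → sumTo (suc (suc m)) (expand₂′ p))
  sumTo-expand₂′ = trans det-expand₂ (sumTo-cong (suc (suc m)) λ p p<n → sym (begin
    sumTo (suc (suc m)) (expand₂′ p)                            ≡⟨ sumTo-punchIn (suc m) p (expand₂′ p) p<n ⟩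
    expand₂′ p p + sumTo (suc m) (λ q → expand₂′ p (punchIn p q)) ≡⟨ cong₂ _+_ (expand₂′-diagonal p)
                                                                             (sumTo-cong (suc m) (λ q _ → expand₂′-punchIn p q)) ⟩
    0ℚ + sumTo (suc m) (expand₂ p)                               ≡⟨ ℚ.+-identityˡ _ ⟩
    sumTo (suc m) (expand₂ p)                                    ∎))

  module _ (columns-equal : ∀ i → M i 0 ≐ M i 1) where

    -- exchanging the rows used by the two equal columns only moves the two letters and flips one sign
    expand₂-antisym : ∀ p q → p ≤ q → q < suc m → expand₂ p q ≡ - expand₂ (suc q) p
    expand₂-antisym p q p≤q q<m = begin
      negOnePow p * (negOnePow q * X)  ≡⟨ cong (λ z → negOnePow p * (negOnePow q * z)) X≡Y ⟩
      negOnePow p * (negOnePow q * Y)  ≡⟨ solve 3 (λ s t y → s :* (t :* y) := :- ((:- t) :* (s :* y))) refl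
                                                  (negOnePow p) (negOnePow q) Y ⟩
      - expand₂ (suc q) p               ∎
      where
      open +-*-Solver
      D : ℤ → ℤ → ℚ
      D x y = det m (minor q (minor p M)) (λ w → f (insertAt p x (insertAt q y w)))
      D′ : ℤ → ℤ → ℚ
      D′ y x = det m (minor p (minor (suc q) M)) (λ w → f (insertAt (suc q) y (insertAt p x w)))
      X = pair (M p 0) (λ x → pair (M (punchIn p q) 1) (D x))
      Y = pair (M (suc q) 0) (λ y → pair (M (punchIn (suc q) p) 1) (D′ y))
      D≡D′ : ∀ x y → D x y ≡ D′ y x
      D≡D′ x y = det-cong m (λ i c _ g → cong (λ r → pair (M r (suc (suc c))) g) (punchIn-punchIn p q i p≤q))
        (λ w ∣w∣ → cong f (insertAt-insertAt p q x y w p≤q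
                             (ℕ.≤-trans p≤q (ℕ.≤-trans (ℕ.s≤s⁻¹ q<m) (ℕ.≤-reflexive (sym ∣w∣))))))
      X≡Y : X ≡ Y
      X≡Y = begin
        X
          ≡⟨ cong (λ r → pair (M p 0) (λ x → pair (M r 1) (D x))) (punchIn-≤ p q p≤q) ⟩
        pair (M p 0) (λ x → pair (M (suc q) 1) (D x))
          ≡⟨ pair-swap (M p 0) (M (suc q) 1) D ⟩
        pair (M (suc q) 1) (λ y → pair (M p 0) (λ x → D x y))
          ≡⟨ columns-equal (suc q) _ ⟨
        pair (M (suc q) 0) (λ y → pair (M p 0) (λ x → D x y))
          ≡⟨ pair-cong (M (suc q) 0) (λ y → columns-equal p _) ⟩
        pair (M (suc q) 0) (λ y → pair (M p 1) (λ x → D x y))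
          ≡⟨ pair-cong (M (suc q) 0) (λ y → pair-cong (M p 1) (λ x → D≡D′ x y)) ⟩
        pair (M (suc q) 0) (λ y → pair (M p 1) (D′ y))
          ≡⟨ cong (λ r → pair (M (suc q) 0) (λ y → pair (M r 1) (D′ y))) (punchIn-> q p p≤q) ⟨
        Y ∎

    expand₂-antisym′ : ∀ p r → p < r → r < suc (suc m) → expand₂ p (punchOut p r) ≡ - expand₂ r (punchOut r p)
    expand₂-antisym′ p (suc q) (s≤s p≤q) (s≤s q<m) = begin
      expand₂ p (punchOut p (suc q))        ≡⟨ cong (expand₂ p) (punchOut-≤ p q p≤q) ⟩
      expand₂ p q                           ≡⟨ expand₂-antisym p q p≤q q<m ⟩
      - expand₂ (suc q) p                   ≡⟨ cong (λ z → - expand₂ (suc q) z) (punchOut-> q p p≤q) ⟨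
      - expand₂ (suc q) (punchOut (suc q) p) ∎

    expand₂′-antisym : ∀ p r → p < suc (suc m) → r < suc (suc m) → expand₂′ p r ≡ - expand₂′ r p
    expand₂′-antisym p r p<n r<n with p ℕ.≟ r | r ℕ.≟ p
    ... | yes _   | yes _   = refl
    ... | yes p≡r | no r≢p  = ⊥-elim (r≢p (sym p≡r))
    ... | no p≢r  | yes r≡p = ⊥-elim (p≢r (sym r≡p))
    ... | no p≢r  | no _    with ℕ.<-cmp p r
    ...   | tri≈ _ p≡r _ = ⊥-elim (p≢r p≡r)
    ...   | tri< p<r _ _ = expand₂-antisym′ p r p<r r<n
    ...   | tri> _ _ r<p = sym (trans (cong -_ (expand₂-antisym′ r p r<p p<n)) (⁻¹-involutive _))

    det-equalColumns : det (suc (suc m)) M f ≡ 0ℚ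
    det-equalColumns = trans sumTo-expand₂′ (neg-fixed⇒0 S (begin
      S                                              ≡⟨ sumTo-swap n n expand₂′ ⟩
      sumTo n (λ r → sumTo n (λ p → expand₂′ p r))   ≡⟨ sumTo-cong n (λ r r<n → sumTo-cong n (λ p p<n →
                                                          expand₂′-antisym p r p<n r<n)) ⟩
      sumTo n (λ r → sumTo n (λ p → - expand₂′ r p)) ≡⟨ sumTo-cong n (λ r _ → sumTo-neg n (expand₂′ r)) ⟩
      sumTo n (λ r → - sumTo n (expand₂′ r))         ≡⟨ sumTo-neg n (λ r → sumTo n (expand₂′ r)) ⟩
      - S                                            ∎))
      where
      n = suc (suc m)
      S = sumTo n (λ p → sumTo n (expand₂′ p))

withColumn0 : (ℕ → Combo ℤ) → Matrix → Matrix
withColumn0 e M i zero    = e i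
withColumn0 e M i (suc c) = M i (suc c)

det-subtractColumn1 : ∀ m M (f : List ℤ → ℚ) →
  det (suc (suc m)) (withColumn0 (λ i → M i 0 ++ negCombo (M i 1)) M) f ≡ det (suc (suc m)) M f
det-subtractColumn1 m M f = begin
  sumTo n (λ p → negOnePow p * pair (M p 0 ++ negCombo (M p 1)) (D p))
    ≡⟨ sumTo-cong n (λ p _ → begin
         negOnePow p * pair (M p 0 ++ negCombo (M p 1)) (D p)
           ≡⟨ cong (negOnePow p *_) (pair-++-negCombo (M p 0) (M p 1) (D p)) ⟩
         negOnePow p * (pair (M p 0) (D p) - pair (M p 1) (D p))
           ≡⟨ trans (ℚ.*-distribˡ-+ (negOnePow p) _ _)
                    (cong (_+_ (negOnePow p * pair (M p 0) (D p))) (sym (ℚ.neg-distribʳ-* (negOnePow p) _))) ⟩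
         negOnePow p * pair (M p 0) (D p) - negOnePow p * pair (M p 1) (D p) ∎) ⟩
  sumTo n (λ p → negOnePow p * pair (M p 0) (D p) - negOnePow p * pair (M p 1) (D p))
    ≡⟨ trans (sumTo-distrib n (λ p → negOnePow p * pair (M p 0) (D p)) (λ p → - (negOnePow p * pair (M p 1) (D p))))
             (cong (_+_ (det n M f)) (sumTo-neg n (λ p → negOnePow p * pair (M p 1) (D p)))) ⟩
  det n M f - det n (withColumn0 (λ i → M i 1) M) f
    ≡⟨ cong (λ z → det n M f - z) (det-equalColumns m (withColumn0 (λ i → M i 1) M) f (λ i g → refl)) ⟩
  det n M f - 0ℚ
    ≡⟨ ℚ.+-identityʳ _ ⟩
  det n M f ∎
  where
  n = suc (suc m)
  D : ℕ → ℤ → ℚ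
  D p x = det (suc m) (minor p M) (λ w → f (insertAt p x w))

det-sumRow : ∀ m n r (Ms : ℕ → Matrix) (M : Matrix) (f : List ℤ → ℚ) → r < m →
  (∀ c → M r c ≐ concatTo n (λ b → Ms b r c)) →
  (∀ b i c → i ≢ r → Ms b i c ≐ M i c) →
  sumTo n (λ b → det m (Ms b) f) ≡ det m M f
det-sumRow (suc m) n r Ms M f r<m row-r rows≢r = begin
  sumTo n (λ b → sumTo (suc m) (λ p → negOnePow p * pair (Ms b p 0) (D b p)))
    ≡⟨ sumTo-swap n (suc m) (λ b p → negOnePow p * pair (Ms b p 0) (D b p)) ⟩
  sumTo (suc m) (λ p → sumTo n (λ b → negOnePow p * pair (Ms b p 0) (D b p)))
    ≡⟨ sumTo-cong (suc m) (λ p p<m → trans (sumTo-*ˡ n (negOnePow p) (λ b → pair (Ms b p 0) (D b p)))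
                                           (cong (negOnePow p *_) (row p p<m (p ℕ.≟ r)))) ⟩
  det (suc m) M f ∎
  where
  D : ℕ → ℕ → ℤ → ℚ
  D b p x = det m (minor p (Ms b)) (λ w → f (insertAt p x w))
  D′ : ℕ → ℤ → ℚ
  D′ p x = det m (minor p M) (λ w → f (insertAt p x w))
  row : ∀ p → p < suc m → Dec (p ≡ r) → sumTo n (λ b → pair (Ms b p 0) (D b p)) ≡ pair (M p 0) (D′ p)
  row p _ (yes refl) = begin
    sumTo n (λ b → pair (Ms b p 0) (D b p))
      ≡⟨ sumTo-cong n (λ b _ → pair-cong (Ms b p 0) (λ x →
           det-cong m (λ i c _ → rows≢r b (punchIn p i) (suc c) (punchInᵢ≢i p i)) (λ _ _ → refl))) ⟩
    sumTo n (λ b → pair (Ms b p 0) (D′ p))       ≡⟨ pair-concatTo n (λ b → Ms b p 0) (D′ p) ⟨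
    pair (concatTo n (λ b → Ms b p 0)) (D′ p)    ≡⟨ row-r 0 (D′ p) ⟨
    pair (M p 0) (D′ p)                          ∎
  row p p<m (no p≢r) = begin
    sumTo n (λ b → pair (Ms b p 0) (D b p))      ≡⟨ sumTo-cong n (λ b _ → rows≢r b p 0 p≢r (D b p)) ⟩
    sumTo n (λ b → pair (M p 0) (D b p))         ≡⟨ pair-sumTo (M p 0) n (λ x b → D b p x) ⟨
    pair (M p 0) (λ x → sumTo n (λ b → D b p x)) ≡⟨ pair-cong (M p 0) (λ x → det-sumRow m n (punchOut p r) (λ b → minor p (Ms b))
                                                       (minor p M) _ (punchOut-< m p r p<m r<m p≢r) row-r′ rows≢r′) ⟩
    pair (M p 0) (D′ p)                          ∎
    where
    row-r′ : ∀ c → minor p M (punchOut p r) c ≐ concatTo n (λ b → minor p (Ms b) (punchOut p r) c)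
    row-r′ c rewrite punchIn-punchOut p r p≢r = row-r (suc c)
    rows≢r′ : ∀ b i c → i ≢ punchOut p r → minor p (Ms b) i c ≐ minor p M i c
    rows≢r′ b i c i≢r′ = rows≢r b (punchIn p i) (suc c) λ eq →
      i≢r′ (punchIn-injective p i (punchOut p r) (trans eq (sym (punchIn-punchOut p r p≢r))))

-- The Leibniz formula for 𝔖_α

sumOver-insertions : ∀ x (l : List ℕ) (h : List ℕ → ℚ) →
  sumOver (insertions x l) h ≡ sumTo (suc (length l)) (λ p → h (insertAt p x l))
sumOver-insertions x []      h = refl
sumOver-insertions x (y ∷ l) h =
  cong (_+_ (h (x ∷ y ∷ l))) (trans (sumOver-map (y ∷_) (insertions x l) h) (sumOver-insertions x l _))

insertions-map : ∀ (g : ℕ → ℕ) x l → insertions (g x) (map g l) ≡ map (map g) (insertions x l)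
insertions-map g x []      = refl
insertions-map g x (y ∷ l) = cong ((g x ∷ g y ∷ map g l) ∷_) (begin
  map (g y ∷_) (insertions (g x) (map g l))    ≡⟨ cong (map (g y ∷_)) (insertions-map g x l) ⟩
  map (g y ∷_) (map (map g) (insertions x l))  ≡⟨ List.map-∘ (insertions x l) ⟨
  map (λ w → g y ∷ map g w) (insertions x l)   ≡⟨ List.map-∘ (insertions x l) ⟩
  map (map g) (map (y ∷_) (insertions x l))    ∎)

sumOver-perms-map : ∀ (g : ℕ → ℕ) l (F : List ℕ → ℚ) →
  sumOver (perms (map g l)) F ≡ sumOver (perms l) (λ σ → F (map g σ))
sumOver-perms-map g []      F = refl
sumOver-perms-map g (x ∷ l) F = begin
  sumOver (concatMap (insertions (g x)) (perms (map g l))) F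
    ≡⟨ sumOver-concatMap _ (perms (map g l)) F ⟩
  sumOver (perms (map g l)) (λ σ → sumOver (insertions (g x) σ) F)
    ≡⟨ sumOver-perms-map g l _ ⟩
  sumOver (perms l) (λ τ → sumOver (insertions (g x) (map g τ)) F)
    ≡⟨ sumOver-cong (perms l) (λ τ → trans (cong (λ ws → sumOver ws F) (insertions-map g x τ))
                                             (sumOver-map (map g) (insertions x τ) F)) ⟩
  sumOver (perms l) (λ τ → sumOver (insertions x τ) (λ σ → F (map g σ)))
    ≡⟨ sumOver-concatMap _ (perms l) _ ⟨
  sumOver (concatMap (insertions x) (perms l)) (λ σ → F (map g σ)) ∎

sumOver-perms-cong : ∀ l {F F′ : List ℕ → ℚ} → (∀ σ → length σ ≡ length l → F σ ≡ F′ σ) →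
  sumOver (perms l) F ≡ sumOver (perms l) F′
sumOver-perms-cong []      eq = cong (_+ 0ℚ) (eq [] refl)
sumOver-perms-cong (x ∷ l) {F} {F′} eq = begin
  sumOver (concatMap (insertions x) (perms l)) F    ≡⟨ sumOver-concatMap _ (perms l) F ⟩
  sumOver (perms l) (λ τ → sumOver (insertions x τ) F)
    ≡⟨ sumOver-perms-cong l (λ τ ∣τ∣ → begin
         sumOver (insertions x τ) F                                 ≡⟨ sumOver-insertions x τ F ⟩
         sumTo (suc (length τ)) (λ p → F (insertAt p x τ))
           ≡⟨ sumTo-cong (suc (length τ)) (λ p _ → eq (insertAt p x τ) (trans (length-insertAt p x τ) (cong suc ∣τ∣))) ⟩
         sumTo (suc (length τ)) (λ p → F′ (insertAt p x τ))        ≡⟨ sumOver-insertions x τ F′ ⟨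
         sumOver (insertions x τ) F′                                ∎) ⟩
  sumOver (perms l) (λ τ → sumOver (insertions x τ) F′)
    ≡⟨ sumOver-concatMap _ (perms l) F′ ⟨
  sumOver (concatMap (insertions x) (perms l)) F′   ∎

countBelow : ℕ → List ℕ → ℕ
countBelow t l = length (filterᵇ (λ y → ⌊ y ℕ.<? t ⌋) l)

countBelow-zero : ∀ l → countBelow 0 l ≡ 0
countBelow-zero []      = refl
countBelow-zero (y ∷ l) = countBelow-zero l

countBelow-map-suc : ∀ t l → countBelow (suc t) (map suc l) ≡ countBelow t l
countBelow-map-suc t []      = refl
countBelow-map-suc t (y ∷ l)
  rewrite ⌊⌋-⇔ (mk⇔ ℕ.s<s⁻¹ ℕ.s<s) (suc y ℕ.<? suc t) (y ℕ.<? t) with ⌊ y ℕ.<? t ⌋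
... | true  = cong suc (countBelow-map-suc t l)
... | false = countBelow-map-suc t l

countBelow-insert0 : ∀ t p l → countBelow (suc t) (insertAt p 0 l) ≡ suc (countBelow (suc t) l)
countBelow-insert0 t zero    l       = refl
countBelow-insert0 t (suc p) []      = refl
countBelow-insert0 t (suc p) (y ∷ l) with ⌊ y ℕ.<? suc t ⌋
... | true  = cong suc (countBelow-insert0 t p l)
... | false = countBelow-insert0 t p l

inversions-map-suc : ∀ l → inversions (map suc l) ≡ inversions l
inversions-map-suc []      = refl
inversions-map-suc (x ∷ l) = cong₂ ℕ._+_ (countBelow-map-suc x l) (inversions-map-suc l)

inversions-insert0 : ∀ p τ → p ≤ length τ → inversions (insertAt p 0 (map suc τ)) ≡ p ℕ.+ inversions τ
inversions-insert0 zero    τ       _         = cong₂ ℕ._+_ (countBelow-zero (map suc τ)) (inversions-map-suc τ)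
inversions-insert0 (suc p) (t ∷ τ) (s≤s p≤τ) = begin
  countBelow (suc t) (insertAt p 0 (map suc τ)) ℕ.+ inversions (insertAt p 0 (map suc τ))
    ≡⟨ cong₂ ℕ._+_ (trans (countBelow-insert0 t p (map suc τ)) (cong suc (countBelow-map-suc t τ)))
                   (inversions-insert0 p τ p≤τ) ⟩
  suc (countBelow t τ ℕ.+ (p ℕ.+ inversions τ))
    ≡⟨ cong suc (ℕ.+-comm (countBelow t τ) _) ⟩
  suc ((p ℕ.+ inversions τ) ℕ.+ countBelow t τ)
    ≡⟨ cong suc (ℕ.+-assoc p _ _) ⟩
  suc (p ℕ.+ (inversions τ ℕ.+ countBelow t τ))
    ≡⟨ cong (λ n → suc (p ℕ.+ n)) (ℕ.+-comm (inversions τ) _) ⟩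
  suc p ℕ.+ inversions (t ∷ τ) ∎

wordOf : (ℕ → ℕ → ℤ) → List ℕ → List ℤ
wordOf L []      = []
wordOf L (r ∷ ρ) = L 0 r ∷ wordOf (λ i → L (suc i)) ρ

wordOf-map-suc : ∀ L τ → wordOf L (map suc τ) ≡ wordOf (λ i c → L i (suc c)) τ
wordOf-map-suc L []      = refl
wordOf-map-suc L (t ∷ τ) = cong (L 0 (suc t) ∷_) (wordOf-map-suc (λ i → L (suc i)) τ)

wordOf-insert0 : ∀ L p τ → p ≤ length τ →
  wordOf L (insertAt p 0 (map suc τ)) ≡ insertAt p (L p 0) (wordOf (λ i c → L (punchIn p i) (suc c)) τ)
wordOf-insert0 L zero    τ       _         = cong (L 0 0 ∷_) (wordOf-map-suc (λ i → L (suc i)) τ)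
wordOf-insert0 L (suc p) (t ∷ τ) (s≤s p≤τ) = cong (L 0 (suc t) ∷_) (wordOf-insert0 (λ i → L (suc i)) p τ p≤τ)

leibnizTerm : (ℕ → ℕ → ℤ) → (List ℤ → ℚ) → List ℕ → ℚ
leibnizTerm L f ρ = negOnePow (inversions ρ) * f (wordOf L ρ)

-- inserting 0 at position p of a permutation of 1, …, m selects the letter in row p and column 0
leibnizTerm-insert0 : ∀ L f p τ → p ≤ length τ →
  leibnizTerm L f (insertAt p 0 (map suc τ))
    ≡ negOnePow p * leibnizTerm (λ i c → L (punchIn p i) (suc c)) (λ w → f (insertAt p (L p 0) w)) τ
leibnizTerm-insert0 L f p τ p≤τ = begin
  negOnePow (inversions (insertAt p 0 (map suc τ))) * f (wordOf L (insertAt p 0 (map suc τ)))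
    ≡⟨ cong₂ _*_ (trans (cong negOnePow (inversions-insert0 p τ p≤τ)) (negOnePow-+ p (inversions τ)))
                 (cong f (wordOf-insert0 L p τ p≤τ)) ⟩
  (negOnePow p * negOnePow (inversions τ)) * f (insertAt p (L p 0) (wordOf (λ i c → L (punchIn p i) (suc c)) τ))
    ≡⟨ ℚ.*-assoc (negOnePow p) _ _ ⟩
  negOnePow p * leibnizTerm (λ i c → L (punchIn p i) (suc c)) (λ w → f (insertAt p (L p 0) w)) τ ∎

det-leibniz : ∀ m L (f : List ℤ → ℚ) → sumOver (perms (upTo m)) (leibnizTerm L f) ≡ det m (letterMatrix L) f
det-leibniz zero    L f = trans (ℚ.+-identityʳ _) (ℚ.*-identityˡ (f []))
det-leibniz (suc m) L f = begin
  sumOver (concatMap (insertions 0) (perms (applyUpTo suc m))) (leibnizTerm L f)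
    ≡⟨ sumOver-concatMap _ (perms (applyUpTo suc m)) (leibnizTerm L f) ⟩
  sumOver (perms (applyUpTo suc m)) (λ σ → sumOver (insertions 0 σ) (leibnizTerm L f))
    ≡⟨ cong (λ l → sumOver (perms l) (λ σ → sumOver (insertions 0 σ) (leibnizTerm L f))) (List.map-applyUpTo id suc m) ⟨
  sumOver (perms (map suc (upTo m))) (λ σ → sumOver (insertions 0 σ) (leibnizTerm L f))
    ≡⟨ sumOver-perms-map suc (upTo m) _ ⟩
  sumOver (perms (upTo m)) (λ τ → sumOver (insertions 0 (map suc τ)) (leibnizTerm L f))
    ≡⟨ sumOver-perms-cong (upTo m) (λ τ ∣τ∣ → trans (sumOver-insertions 0 (map suc τ) (leibnizTerm L f))
                                                    (insert0-terms τ (trans ∣τ∣ (List.length-upTo m)))) ⟩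
  sumOver (perms (upTo m)) (λ τ → sumTo (suc m) (λ p → negOnePow p * leibnizTerm (L′ p) (f′ p) τ))
    ≡⟨ sumOver-sumTo (perms (upTo m)) (suc m) (λ τ p → negOnePow p * leibnizTerm (L′ p) (f′ p) τ) ⟩
  sumTo (suc m) (λ p → sumOver (perms (upTo m)) (λ τ → negOnePow p * leibnizTerm (L′ p) (f′ p) τ))
    ≡⟨ sumTo-cong (suc m) (λ p _ → trans (sumOver-*ˡ (perms (upTo m)) (negOnePow p) (leibnizTerm (L′ p) (f′ p)))
                                         (cong (negOnePow p *_) (trans (det-leibniz m (L′ p) (f′ p)) (sym (pair-letter (L p 0) (D p)))))) ⟩
  det (suc m) (letterMatrix L) f ∎
  where
  L′ : ℕ → ℕ → ℕ → ℤ
  L′ p i c = L (punchIn p i) (suc c)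
  f′ : ℕ → List ℤ → ℚ
  f′ p w = f (insertAt p (L p 0) w)
  D : ℕ → ℤ → ℚ
  D p x = det m (letterMatrix (L′ p)) (λ w → f (insertAt p x w))
  insert0-terms : ∀ τ → length τ ≡ m → sumTo (suc (length (map suc τ))) (λ p → leibnizTerm L f (insertAt p 0 (map suc τ)))
                                       ≡ sumTo (suc m) (λ p → negOnePow p * leibnizTerm (L′ p) (f′ p) τ)
  insert0-terms τ ∣τ∣ rewrite List.length-map suc τ | ∣τ∣ =
    sumTo-cong (suc m) (λ p p<1+m → leibnizTerm-insert0 L f p τ (ℕ.≤-trans (ℕ.s≤s⁻¹ p<1+m) (ℕ.≤-reflexive (sym ∣τ∣))))

-- the letter α_i + c − i of the matrix of 𝔖_α, with rows and columns counted from 0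
𝔖-letter : List ℤ → ℕ → ℕ → ℤ
𝔖-letter α i c = lookupOr (+ 0) α i ℤ.+ (+ c ℤ.- + i)

zipWith-wordOf : ∀ (α : List ℤ) (ks ρ : List ℕ) → length ρ ≡ length α → length ks ≡ length α →
  zipWith ℤ._+_ α (zipWith (λ s i → + s ℤ.- + i) (map suc ρ) ks)
    ≡ wordOf (λ i c → lookupOr (+ 0) α i ℤ.+ (+ suc c ℤ.- + lookupOr 0 ks i)) ρ
zipWith-wordOf []      []       []      _    _    = refl
zipWith-wordOf (a ∷ α) (k ∷ ks) (r ∷ ρ) ∣ρ∣ ∣ks∣ =
  cong (_ ∷_) (zipWith-wordOf α ks ρ (ℕ.suc-injective ∣ρ∣) (ℕ.suc-injective ∣ks∣))

pair-𝔖 : ∀ α (f : List ℤ → ℚ) → pair (𝔖 α) f ≡ det (length α) (letterMatrix (𝔖-letter α)) f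
pair-𝔖 α f = begin
  pair (𝔖 α) f
    ≡⟨ sumOver-map (λ σ → sgn σ , word σ) (perms (oneTo m)) _ ⟩
  sumOver (perms (map suc (upTo m))) (λ σ → sgn σ * f (word σ))
    ≡⟨ sumOver-perms-map suc (upTo m) _ ⟩
  sumOver (perms (upTo m)) (λ ρ → sgn (map suc ρ) * f (word (map suc ρ)))
    ≡⟨ sumOver-perms-cong (upTo m) (λ ρ ∣ρ∣ →
         cong₂ _*_ (cong negOnePow (inversions-map-suc ρ))
                   (cong f (zipWith-wordOf α (oneTo m) ρ (trans ∣ρ∣ (List.length-upTo m)) ∣oneTo∣))) ⟩
  sumOver (perms (upTo m)) (leibnizTerm L f)
    ≡⟨ det-leibniz m L f ⟩
  det m (letterMatrix L) f
    ≡⟨ det-cong m (λ i c i<m → letter-cong (cong (ℤ._+_ (lookupOr (+ 0) α i)) (shift i c i<m))) (λ _ _ → refl) ⟩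
  det m (letterMatrix (𝔖-letter α)) f ∎
  where
  m = length α
  word : List ℕ → List ℤ
  word σ = zipWith ℤ._+_ α (zipWith (λ s i → + s ℤ.- + i) σ (oneTo m))
  L : ℕ → ℕ → ℤ
  L i c = lookupOr (+ 0) α i ℤ.+ (+ suc c ℤ.- + lookupOr 0 (oneTo m) i)
  ∣oneTo∣ : length (oneTo m) ≡ m
  ∣oneTo∣ = trans (List.length-map suc (upTo m)) (List.length-upTo m)
  shift : ∀ i c → i < m → + suc c ℤ.- + lookupOr 0 (oneTo m) i ≡ + c ℤ.- + i
  shift i c i<m = trans (cong (λ k → + suc c ℤ.- + k) (lookupOr-oneTo i i<m)) ([1+m]-[1+n]≡m-n c i)

wordSum : List ℤ → ℤ
wordSum = foldr ℤ._+_ 0ℤ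

wordSum-insertAt : ∀ p x w → wordSum (insertAt p x w) ≡ x ℤ.+ wordSum w
wordSum-insertAt zero    x w       = refl
wordSum-insertAt (suc p) x []      = refl
wordSum-insertAt (suc p) x (y ∷ w) = begin
  y ℤ.+ wordSum (insertAt p x w) ≡⟨ cong (ℤ._+_ y) (wordSum-insertAt p x w) ⟩
  y ℤ.+ (x ℤ.+ wordSum w)         ≡⟨ ℤ.+-assoc y x _ ⟨
  (y ℤ.+ x) ℤ.+ wordSum w         ≡⟨ cong (ℤ._+ wordSum w) (ℤ.+-comm y x) ⟩
  (x ℤ.+ y) ℤ.+ wordSum w         ≡⟨ ℤ.+-assoc x y _ ⟩
  x ℤ.+ (y ℤ.+ wordSum w)         ∎

wordSum-nonNegative : ∀ w → ¬ Any (ℤ._< 0ℤ) w → ∃ λ t → wordSum w ≡ + t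
wordSum-nonNegative w = go w ∘ ¬Any⇒All¬ w
  where
  go : ∀ w → All (λ x → ¬ x ℤ.< 0ℤ) w → ∃ λ t → wordSum w ≡ + t
  go []              []         = 0 , refl
  go (+ a ∷ w)       (_ ∷ w≥0) = let t , eq = go w w≥0 in a ℕ.+ t , cong (ℤ._+_ (+ a)) eq
  go (-[1+ n ] ∷ w)  (x≮0 ∷ _) = ⊥-elim (x≮0 ℤ.-<+)

Any-insertAt⁺ : ∀ {P : ℤ → Set} p x w → Any P w → Any P (insertAt p x w)
Any-insertAt⁺ zero    x w       pw         = there pw
Any-insertAt⁺ (suc p) x (y ∷ w) (here py)  = here py
Any-insertAt⁺ (suc p) x (y ∷ w) (there pw) = there (Any-insertAt⁺ p x w pw)

Any-insertAt-here : ∀ {P : ℤ → Set} p x w → P x → Any P (insertAt p x w)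
Any-insertAt-here zero    x w       px = here px
Any-insertAt-here (suc p) x []      px = here px
Any-insertAt-here (suc p) x (y ∷ w) px = there (Any-insertAt-here p x w px)

-- the conventions H_i = 0 for i < 0 and H_0 = 1
record Regular (f : List ℤ → ℚ) : Set where
  field
    vanishes-negative : ∀ w → Any (ℤ._< 0ℤ) w → f w ≡ 0ℚ
    ignores-zero      : ∀ p w → f (insertAt p 0ℤ w) ≡ f w

open Regular public

Homogeneous : ℕ → (List ℤ → ℚ) → Set
Homogeneous K f = ∀ w → wordSum w ≢ + K → f w ≡ 0ℚ

vanishes-insertNegative : ∀ {f} → Regular f → ∀ p n w → f (insertAt p -[1+ n ] w) ≡ 0ℚ
vanishes-insertNegative reg p n w = vanishes-negative reg _ (Any-insertAt-here p _ w ℤ.-<+)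

vanishes-insertLarge : ∀ {f K} → Regular f → Homogeneous K f → ∀ p x w → K < x → f (insertAt p (+ x) w) ≡ 0ℚ
vanishes-insertLarge {K = K} reg hom p x w K<x with any? (ℤ._<? 0ℤ) w
... | yes neg = vanishes-negative reg _ (Any-insertAt⁺ p (+ x) w neg)
... | no ¬neg = hom _ λ eq → ℕ.<-irrefl refl (ℕ.<-≤-trans K<x (ℕ.≤-trans (ℕ.m≤m+n x t) (ℕ.≤-reflexive (ℤ.+-injective (begin
      + (x ℕ.+ t)                  ≡⟨ cong (ℤ._+_ (+ x)) wt ⟨
      + x ℤ.+ wordSum w            ≡⟨ wordSum-insertAt p (+ x) w ⟨
      wordSum (insertAt p (+ x) w) ≡⟨ eq ⟩
      + K                          ∎)))))
  where
  t = proj₁ (wordSum-nonNegative w ¬neg)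
  wt = proj₂ (wordSum-nonNegative w ¬neg)

Regular-prefix : ∀ {f} a → Regular f → Regular (λ w → f (+ a ∷ w))
Regular-prefix a reg .vanishes-negative w neg = vanishes-negative reg (+ a ∷ w) (there neg)
Regular-prefix a reg .ignores-zero      p w   = ignores-zero reg (suc p) (+ a ∷ w)

Regular-suffix : ∀ {f} x → Regular f → Regular (λ w → f (w ++ x ∷ []))
Regular-suffix x reg .vanishes-negative w neg = vanishes-negative reg _ (++⁺ˡ neg)
Regular-suffix {f} x reg .ignores-zero p w with p ℕ.≤? length w
... | yes p≤w = trans (cong f (insertAt-++ p 0ℤ w (x ∷ []) p≤w)) (ignores-zero reg p (w ++ x ∷ []))
... | no  p≰w = trans (cong f (begin
      insertAt p 0ℤ w ++ x ∷ []         ≡⟨ cong (_++ x ∷ []) (insertAt-beyond p 0ℤ w (ℕ.<⇒≤ (ℕ.≰⇒> p≰w))) ⟩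
      (w ++ 0ℤ ∷ []) ++ x ∷ []           ≡⟨ List.++-assoc w (0ℤ ∷ []) (x ∷ []) ⟩
      w ++ 0ℤ ∷ x ∷ []                   ≡⟨ insertAt-length 0ℤ w (x ∷ []) ⟨
      insertAt (length w) 0ℤ (w ++ x ∷ []) ∎))
    (ignores-zero reg (length w) (w ++ x ∷ []))

Homogeneous-prefix : ∀ {f K} a → a ≤ K → Homogeneous K f → Homogeneous (K ∸ a) (λ w → f (+ a ∷ w))
Homogeneous-prefix {K = K} a a≤K hom w ≢K-a = hom (+ a ∷ w) λ eq → ≢K-a (+-cancelˡ (+ a) _ _ (begin
  + a ℤ.+ wordSum w   ≡⟨ eq ⟩
  + K                 ≡⟨ cong +_ (ℕ.m+[n∸m]≡n a≤K) ⟨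
  + (a ℕ.+ (K ∸ a))   ∎))

basisCoeff : List ℕ → Maybe (List ℕ) → ℚ
basisCoeff v nothing  = 0ℚ
basisCoeff v (just u) = if ⌊ List.≡-dec ℕ._≟_ u v ⌋ then 1ℚ else 0ℚ

χ : List ℕ → List ℤ → ℚ
χ v w = basisCoeff v (normWord w)

coeff-pair : ∀ (x : NSym) v → coeff x v ≡ pair x (χ v)
coeff-pair []            v = refl
coeff-pair ((c , w) ∷ x) v with normWord w
... | nothing = trans (coeff-pair x v) (sym (trans (cong (_+ pair x (χ v)) (ℚ.*-zeroʳ c)) (ℚ.+-identityˡ _)))
... | just u with ⌊ List.≡-dec ℕ._≟_ u v ⌋
...   | true  = cong₂ _+_ (sym (ℚ.*-identityʳ c)) (coeff-pair x v)
...   | false = cong₂ _+_ (sym (ℚ.*-zeroʳ c)) (coeff-pair x v)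

normWord-negative : ∀ w → Any (ℤ._< 0ℤ) w → normWord w ≡ nothing
normWord-negative (-[1+ _ ] ∷ w) _                        = refl
normWord-negative (+ _ ∷ w)      (here (ℤ.+<+ ()))
normWord-negative (+ zero ∷ w)   (there neg)              = normWord-negative w neg
normWord-negative (+ suc n ∷ w)  (there neg) rewrite normWord-negative w neg = refl

normWord-insert0 : ∀ p w → normWord (insertAt p 0ℤ w) ≡ normWord w
normWord-insert0 zero    w              = refl
normWord-insert0 (suc p) []             = refl
normWord-insert0 (suc p) (-[1+ _ ] ∷ w) = refl
normWord-insert0 (suc p) (+ zero ∷ w)   = normWord-insert0 p w
normWord-insert0 (suc p) (+ suc n ∷ w) rewrite normWord-insert0 p w = refl

normWord-wordSum : ∀ w u → normWord w ≡ just u → wordSum w ≡ + sumℕ u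
normWord-wordSum []             u  refl = refl
normWord-wordSum (+ zero ∷ w)   u  eq   = trans (ℤ.+-identityˡ (wordSum w)) (normWord-wordSum w u eq)
normWord-wordSum (+ suc n ∷ w)  u  eq with normWord w in eqw
normWord-wordSum (+ suc n ∷ w)  ._ refl | just v = cong (ℤ._+_ (+ suc n)) (normWord-wordSum w v eqw)

χ-regular : ∀ v → Regular (χ v)
χ-regular v .vanishes-negative w neg = cong (basisCoeff v) (normWord-negative w neg)
χ-regular v .ignores-zero      p w   = cong (basisCoeff v) (normWord-insert0 p w)

χ-homogeneous : ∀ v → Homogeneous (sumℕ v) (χ v)
χ-homogeneous v w ≢∣v∣ = go (normWord w) refl
  where
  go : ∀ mu → normWord w ≡ mu → basisCoeff v mu ≡ 0ℚ
  go nothing  _  = refl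
  go (just u) eq with List.≡-dec ℕ._≟_ u v
  ... | yes refl = ⊥-elim (≢∣v∣ (normWord-wordSum w u eq))
  ... | no  _    = refl

-- The ribbon recursion and 𝔖_(0, …, 0, k)

-- f at the ribbon R_(a, 1^(m−1), K − a − m + 1), or at H_K if m = 0, computed by R_(a,γ) = H_a R_γ − R_(a+γ₁, γ₂, …)
ribbonAt : ℕ → ℕ → ℕ → (List ℤ → ℚ) → ℚ
ribbonAt zero    a K f = f (+ K ∷ [])
ribbonAt (suc m) a K f = ribbonAt m 1 (K ∸ a) (λ w → f (+ a ∷ w)) - ribbonAt m (suc a) K f

-- the letters of 𝔖_(a, 0, …, 0)
leadLetter : ℕ → ℕ → ℕ → ℤ
leadLetter a zero    c = + a ℤ.+ + c
leadLetter a (suc i) c = + suc c ℤ.- + suc i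

det-leadLetter-expand : ∀ t a (g : List ℤ → ℚ) → Regular g →
  det (suc (suc t)) (letterMatrix (leadLetter a)) g
    ≡ det (suc t) (letterMatrix (leadLetter 1)) (λ w → g (+ a ∷ w)) - det (suc t) (letterMatrix (leadLetter (suc a))) g
det-leadLetter-expand t a g reg = begin
  1ℚ * T 0 + (- 1ℚ * T 1 + sumTo t (λ i → negOnePow (suc (suc i)) * T (suc (suc i))))
    ≡⟨ cong₂ (λ x y → 1ℚ * x + (- 1ℚ * y + sumTo t (λ i → negOnePow (suc (suc i)) * T (suc (suc i))))) T0 T1 ⟩
  1ℚ * X + (- 1ℚ * Y + sumTo t (λ i → negOnePow (suc (suc i)) * T (suc (suc i))))
    ≡⟨ cong (λ z → 1ℚ * X + (- 1ℚ * Y + z))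
            (sumTo-zero t (λ i _ → trans (cong (negOnePow (suc (suc i)) *_) (T-negative i)) (ℚ.*-zeroʳ (negOnePow (suc (suc i)))))) ⟩
  1ℚ * X + (- 1ℚ * Y + 0ℚ)
    ≡⟨ solve 2 (λ x y → con 1ℚ :* x :+ ((:- con 1ℚ) :* y :+ con 0ℚ) := x :- y) refl X Y ⟩
  X - Y ∎
  where
  open +-*-Solver
  L = leadLetter a
  X = det (suc t) (letterMatrix (leadLetter 1)) (λ w → g (+ a ∷ w))
  Y = det (suc t) (letterMatrix (leadLetter (suc a))) g
  D : ℕ → ℤ → ℚ
  D p x = det (suc t) (minor p (letterMatrix L)) (λ w → g (insertAt p x w))
  T : ℕ → ℚ
  T p = pair (letterMatrix L p 0) (D p)
  T0 : T 0 ≡ X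
  T0 = trans (pair-letter (L 0 0) (D 0)) (det-cong (suc t) {minor 0 (letterMatrix L)} {letterMatrix (leadLetter 1)}
    (λ { zero c _ → letter-cong refl ; (suc i) c _ → letter-cong ([1+m]-[1+n]≡m-n (suc c) (suc i)) })
    (λ w _ → cong (λ n → g (+ n ∷ w)) (ℕ.+-identityʳ a)))
  T1 : T 1 ≡ Y
  T1 = trans (pair-letter (L 1 0) (D 1)) (det-cong (suc t) {minor 1 (letterMatrix L)} {letterMatrix (leadLetter (suc a))}
    (λ { zero c _ → letter-cong (cong +_ (ℕ.+-suc a c)) ; (suc i) c _ → letter-cong ([1+m]-[1+n]≡m-n (suc c) (suc i)) })
    (λ w _ → ignores-zero reg 1 w))
  T-negative : ∀ i → T (suc (suc i)) ≡ 0ℚ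
  T-negative i = trans (pair-letter (L (suc (suc i)) 0) (D (suc (suc i))))
    (det-zero (suc t) (minor (suc (suc i)) (letterMatrix L)) (λ w → g (insertAt (suc (suc i)) (L (suc (suc i)) 0) w))
              (λ w _ → vanishes-insertNegative reg (suc (suc i)) i w))

-- appending the letter that completes degree K turns 𝔖_(a,0,…,0) into two neighbouring ribbons
det-leadLetter-append : ∀ n a K f → Regular f →
  det (suc n) (letterMatrix (leadLetter a)) (λ w → f (w ++ + (K ∸ a ∸ n) ∷ [])) ≡ ribbonAt (suc n) a K f + ribbonAt n a K f
det-leadLetter-append zero a K f reg = begin
  1ℚ * (1ℚ * f (+ a ℤ.+ + 0 ∷ + (K ∸ a) ∷ []) + 0ℚ) + 0ℚ
    ≡⟨ cong (λ n → 1ℚ * (1ℚ * f (+ n ∷ + (K ∸ a) ∷ []) + 0ℚ) + 0ℚ) (ℕ.+-identityʳ a) ⟩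
  1ℚ * (1ℚ * f (+ a ∷ + (K ∸ a) ∷ []) + 0ℚ) + 0ℚ
    ≡⟨ solve 2 (λ x y → con 1ℚ :* (con 1ℚ :* x :+ con 0ℚ) :+ con 0ℚ := (x :- y) :+ y) refl
               (f (+ a ∷ + (K ∸ a) ∷ [])) (f (+ K ∷ [])) ⟩
  ribbonAt 1 a K f + ribbonAt 0 a K f ∎
  where open +-*-Solver
det-leadLetter-append (suc n) a K f reg = begin
  det (suc (suc n)) (letterMatrix (leadLetter a)) g
    ≡⟨ det-leadLetter-expand n a g (Regular-suffix _ reg) ⟩
  det (suc n) (letterMatrix (leadLetter 1)) (λ w → g (+ a ∷ w)) - det (suc n) (letterMatrix (leadLetter (suc a))) g
    ≡⟨ cong₂ _-_
         (trans (cong (λ d → det (suc n) (letterMatrix (leadLetter 1)) (λ w → f (+ a ∷ (w ++ + d ∷ []))))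
                      (sym (ℕ.∸-+-assoc (K ∸ a) 1 n)))
                (det-leadLetter-append n 1 (K ∸ a) (λ w → f (+ a ∷ w)) (Regular-prefix a reg)))
         (trans (cong (λ d → det (suc n) (letterMatrix (leadLetter (suc a))) (λ w → f (w ++ + d ∷ []))) K∸a∸1+n)
                (det-leadLetter-append n (suc a) K f reg)) ⟩
  (P′ + P) - (Q′ + Q)
    ≡⟨ solve 4 (λ p′ p q′ q → (p′ :+ p) :- (q′ :+ q) := (p′ :- q′) :+ (p :- q)) refl P′ P Q′ Q ⟩
  ribbonAt (suc (suc n)) a K f + ribbonAt (suc n) a K f ∎
  where
  open +-*-Solver
  g : List ℤ → ℚ
  g w = f (w ++ + (K ∸ a ∸ suc n) ∷ [])
  P′ = ribbonAt (suc n) 1 (K ∸ a) (λ w → f (+ a ∷ w))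
  P  = ribbonAt n 1 (K ∸ a) (λ w → f (+ a ∷ w))
  Q′ = ribbonAt (suc n) (suc a) K f
  Q  = ribbonAt n (suc a) K f
  K∸a∸1+n : K ∸ a ∸ suc n ≡ K ∸ suc a ∸ n
  K∸a∸1+n = trans (ℕ.∸-+-assoc K a (suc n)) (trans (cong (K ∸_) (ℕ.+-suc a n)) (sym (ℕ.∸-+-assoc K (suc a) n)))

zerosThen : ℕ → ℕ → List ℤ
zerosThen k n = replicate n 0ℤ ++ + k ∷ []

lookup-zerosThen-< : ∀ k n i → i < n → lookupOr 0ℤ (zerosThen k n) i ≡ 0ℤ
lookup-zerosThen-< k (suc n) zero    _         = refl
lookup-zerosThen-< k (suc n) (suc i) (s≤s i<n) = lookup-zerosThen-< k n i i<n

lookup-zerosThen-last : ∀ k n → lookupOr 0ℤ (zerosThen k n) n ≡ + k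
lookup-zerosThen-last k zero    = refl
lookup-zerosThen-last k (suc n) = lookup-zerosThen-last k n

length-zerosThen : ∀ k n → length (zerosThen k n) ≡ suc n
length-zerosThen k zero    = refl
length-zerosThen k (suc n) = cong suc (length-zerosThen k n)

𝔖-letter-zerosThen-last : ∀ k n → 𝔖-letter (zerosThen k n) n 0 ≡ + k ℤ.- + n
𝔖-letter-zerosThen-last k n = trans (cong (ℤ._+ (0ℤ ℤ.- + n)) (lookup-zerosThen-last k n))
  (solve 2 (λ k n → k :+ (con 0ℤ :- n) := k :- n) refl (+ k) (+ n))
  where open ℤ-Solver.+-*-Solver

minor-𝔖-zerosThen-last : ∀ k n i c → i < suc n →
  𝔖-letter (zerosThen k (suc n)) (punchIn (suc n) i) (suc c) ≡ leadLetter 1 i c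
minor-𝔖-zerosThen-last k n zero    c _         =
  solve 1 (λ c → con 0ℤ :+ ((con (+ 1) :+ c) :- con 0ℤ) := con (+ 1) :+ c) refl (+ c)
  where open ℤ-Solver.+-*-Solver
minor-𝔖-zerosThen-last k n (suc i) c (s≤s i≤n) = begin
  𝔖-letter (zerosThen k (suc n)) (punchIn (suc n) (suc i)) (suc c)
    ≡⟨ cong (λ r → 𝔖-letter (zerosThen k (suc n)) r (suc c)) (punchIn-> n (suc i) i≤n) ⟩
  lookupOr 0ℤ (zerosThen k n) i ℤ.+ (+ suc c ℤ.- + suc i)
    ≡⟨ cong (ℤ._+ (+ suc c ℤ.- + suc i)) (lookup-zerosThen-< k n i i≤n) ⟩
  0ℤ ℤ.+ (+ suc c ℤ.- + suc i)
    ≡⟨ ℤ.+-identityˡ _ ⟩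
  leadLetter 1 (suc i) c ∎

-- expansion along column 0: row 0 carries H_0 = 1, rows 1, …, n − 1 negative letters, row n the letter k − n
det-𝔖-zerosThen-expand : ∀ n k f → Regular f →
  det (suc (suc n)) (letterMatrix (𝔖-letter (zerosThen k (suc n)))) f
    ≡ det (suc n) (letterMatrix (𝔖-letter (zerosThen k n))) f
      + negOnePow (suc n) * det (suc n) (letterMatrix (leadLetter 1)) (λ w → f (w ++ + k ℤ.- + suc n ∷ []))
det-𝔖-zerosThen-expand n k f reg = begin
  1ℚ * T 0 + sumTo (suc n) (λ p → negOnePow (suc p) * T (suc p))
    ≡⟨ cong (_+_ (1ℚ * T 0)) (sumTo-last n (λ p → negOnePow (suc p) * T (suc p))) ⟩
  1ℚ * T 0 + (sumTo n (λ p → negOnePow (suc p) * T (suc p)) + negOnePow (suc n) * T (suc n))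
    ≡⟨ cong₂ (λ x y → 1ℚ * x + (y + negOnePow (suc n) * T (suc n))) T-first
         (sumTo-zero n (λ p p<n → trans (cong (negOnePow (suc p) *_) (T-middle p p<n)) (ℚ.*-zeroʳ (negOnePow (suc p))))) ⟩
  1ℚ * X + (0ℚ + negOnePow (suc n) * T (suc n))
    ≡⟨ cong₂ _+_ (ℚ.*-identityˡ X) (trans (ℚ.+-identityˡ _) (cong (negOnePow (suc n) *_) T-last)) ⟩
  X + negOnePow (suc n) * Y ∎
  where
  α = zerosThen k (suc n)
  M = letterMatrix (𝔖-letter α)
  X = det (suc n) (letterMatrix (𝔖-letter (zerosThen k n))) f
  Y = det (suc n) (letterMatrix (leadLetter 1)) (λ w → f (w ++ + k ℤ.- + suc n ∷ []))
  D : ℕ → ℤ → ℚ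
  D p x = det (suc n) (minor p M) (λ w → f (insertAt p x w))
  T : ℕ → ℚ
  T p = pair (M p 0) (D p)
  T-first : T 0 ≡ X
  T-first = trans (pair-letter _ (D 0)) (det-cong (suc n) {minor 0 M} {letterMatrix (𝔖-letter (zerosThen k n))}
    (λ i c _ → letter-cong (cong (ℤ._+_ (lookupOr 0ℤ (zerosThen k n) i)) ([1+m]-[1+n]≡m-n c i)))
    (λ w _ → ignores-zero reg 0 w))
  T-middle : ∀ p → p < n → T (suc p) ≡ 0ℚ
  T-middle p p<n = trans (pair-letter _ (D (suc p))) (det-zero (suc n) (minor (suc p) M) _ λ w _ →
    trans (cong (λ z → f (insertAt (suc p) (z ℤ.+ (0ℤ ℤ.- + suc p)) w)) (lookup-zerosThen-< k n p p<n))
          (vanishes-insertNegative reg (suc p) p w))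
  T-last : T (suc n) ≡ Y
  T-last = trans (pair-letter _ (D (suc n))) (det-cong (suc n) {minor (suc n) M} {letterMatrix (leadLetter 1)}
    (λ i c i<n → letter-cong (minor-𝔖-zerosThen-last k n i c i<n))
    (λ w ∣w∣ → cong f (trans (cong (λ z → insertAt (suc n) z w) (𝔖-letter-zerosThen-last k (suc n)))
                             (insertAt-beyond (suc n) _ w (ℕ.≤-reflexive ∣w∣)))))

det-𝔖-zerosThen : ∀ n k f → Regular f → suc n ≤ k →
  det (suc n) (letterMatrix (𝔖-letter (zerosThen k n))) f ≡ negOnePow n * ribbonAt n 1 k f
det-𝔖-zerosThen zero    k f reg _   =
  trans (det₁-letterMatrix (𝔖-letter (zerosThen k 0)) f)
        (trans (cong (λ z → f (z ∷ [])) (ℤ.+-identityʳ (+ k))) (sym (ℚ.*-identityˡ (f (+ k ∷ [])))))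
det-𝔖-zerosThen (suc n) k f reg n<k = begin
  det (suc (suc n)) (letterMatrix (𝔖-letter (zerosThen k (suc n)))) f
    ≡⟨ det-𝔖-zerosThen-expand n k f reg ⟩
  det (suc n) (letterMatrix (𝔖-letter (zerosThen k n))) f
    + negOnePow (suc n) * det (suc n) (letterMatrix (leadLetter 1)) (λ w → f (w ++ + k ℤ.- + suc n ∷ []))
    ≡⟨ cong₂ (λ x y → x + negOnePow (suc n) * y) (det-𝔖-zerosThen n k f reg (ℕ.≤-trans (ℕ.n≤1+n (suc n)) n<k))
         (trans (cong (λ z → det (suc n) (letterMatrix (leadLetter 1)) (λ w → f (w ++ z ∷ []))) k-1-n)
                (det-leadLetter-append n 1 k f reg)) ⟩
  negOnePow n * R₀ + (- negOnePow n) * (R₁ + R₀)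
    ≡⟨ solve 3 (λ s r₀ r₁ → s :* r₀ :+ (:- s) :* (r₁ :+ r₀) := (:- s) :* r₁) refl (negOnePow n) R₀ R₁ ⟩
  negOnePow (suc n) * R₁ ∎
  where
  open +-*-Solver
  R₀ = ribbonAt n 1 k f
  R₁ = ribbonAt (suc n) 1 k f
  k-1-n : + k ℤ.- + suc n ≡ + (k ∸ 1 ∸ n)
  k-1-n = trans (ℤ.m-n≡m⊖n k (suc n)) (trans (ℤ.⊖-≥ (ℕ.≤-trans (ℕ.n≤1+n (suc n)) n<k)) (cong +_ (sym (ℕ.∸-+-assoc k 1 n))))

-- The ribbon R_(1^n, k − n)

sumOver-compositions : ∀ K (g : List ℕ → ℚ) →
  sumOver (compositions (suc (suc K))) g
    ≡ sumOver (compositions (suc K)) (λ β → g (1 ∷ β)) + sumOver (compositions (suc K)) (λ β → g (incHead β))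
sumOver-compositions K g = begin
  sumOver (map (1 ∷_) C ++ map incHead C) g              ≡⟨ sumOver-++ (map (1 ∷_) C) _ g ⟩
  sumOver (map (1 ∷_) C) g + sumOver (map incHead C) g   ≡⟨ cong₂ _+_ (sumOver-map (1 ∷_) C g) (sumOver-map incHead C g) ⟩
  sumOver C (λ β → g (1 ∷ β)) + sumOver C (λ β → g (incHead β)) ∎
  where C = compositions (suc K)

IsComposition : List ℕ → Set
IsComposition β = All (0 <_) β × 1 ≤ length β

compositions-isComposition : ∀ K → All IsComposition (compositions (suc K))
compositions-isComposition zero    = (s≤s z≤n ∷ [] , s≤s z≤n) ∷ []
compositions-isComposition (suc K) = All.++⁺
  (All.map⁺ (All.map (λ { (pos , _) → s≤s z≤n ∷ pos , s≤s z≤n }) (compositions-isComposition K)))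
  (All.map⁺ (All.map incHead-isComposition (compositions-isComposition K)))
  where
  incHead-isComposition : ∀ {β} → IsComposition β → IsComposition (incHead β)
  incHead-isComposition {a ∷ r} (_ ∷ pos , _) = s≤s z≤n ∷ pos , s≤s z≤n

oneTo-suc : ∀ n → oneTo (suc n) ≡ 1 ∷ map suc (oneTo n)
oneTo-suc n = cong (1 ∷_) (cong (map suc) (sym (List.map-applyUpTo id suc n)))

memb-map-suc : ∀ d L → memb (suc d) (map suc L) ≡ memb d L
memb-map-suc d []      = refl
memb-map-suc d (y ∷ L) = cong₂ _∨_ (⌊⌋-⇔ (mk⇔ ℕ.suc-injective (cong suc)) (suc d ℕ.≟ suc y) (d ℕ.≟ y)) (memb-map-suc d L)

memb-zero-map-suc : ∀ L → memb 0 (map suc L) ≡ false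
memb-zero-map-suc []      = refl
memb-zero-map-suc (y ∷ L) = memb-zero-map-suc L

memb-oneTo-suc : ∀ d n → memb (suc (suc d)) (oneTo (suc n)) ≡ memb (suc d) (oneTo n)
memb-oneTo-suc d n = trans (cong (memb (suc (suc d))) (oneTo-suc n)) (memb-map-suc (suc d) (oneTo n))

memb-oneTo⇒≤ : ∀ d n → memb d (oneTo n) ≡ true → d ≤ n
memb-oneTo⇒≤ zero          (suc n) eq with () ← trans (sym (memb-zero-map-suc (oneTo n))) (trans (cong (memb 0) (sym (oneTo-suc n))) eq)
memb-oneTo⇒≤ (suc zero)    (suc n) eq = s≤s z≤n
memb-oneTo⇒≤ (suc (suc d)) (suc n) eq = s≤s (memb-oneTo⇒≤ (suc d) n (trans (sym (memb-oneTo-suc d n)) eq))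

descentsWithin : ℕ → ℕ → List ℕ → Bool
descentsWithin s n []          = true
descentsWithin s n (a ∷ [])    = true
descentsWithin s n (a ∷ b ∷ r) = memb (s ℕ.+ a) (oneTo n) ∧ descentsWithin (s ℕ.+ a) n (b ∷ r)

and-descentsFrom : ∀ s n β → and (map (λ d → memb d (oneTo n)) (descentsFrom s β)) ≡ descentsWithin s n β
and-descentsFrom s n []          = refl
and-descentsFrom s n (a ∷ [])    = refl
and-descentsFrom s n (a ∷ b ∷ r) = cong (memb (s ℕ.+ a) (oneTo n) ∧_) (and-descentsFrom (s ℕ.+ a) n (b ∷ r))

descentsFrom-hook : ∀ s n x → descentsFrom s (replicate n 1 ++ x ∷ []) ≡ map (s ℕ.+_) (oneTo n)
descentsFrom-hook s zero          x = refl
descentsFrom-hook s (suc zero)    x = refl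
descentsFrom-hook s (suc (suc n)) x = begin
  s ℕ.+ 1 ∷ descentsFrom (s ℕ.+ 1) (replicate (suc n) 1 ++ x ∷ [])
    ≡⟨ cong (s ℕ.+ 1 ∷_) (descentsFrom-hook (s ℕ.+ 1) (suc n) x) ⟩
  s ℕ.+ 1 ∷ map (s ℕ.+ 1 ℕ.+_) (oneTo (suc n))
    ≡⟨ cong (s ℕ.+ 1 ∷_) (trans (List.map-cong (ℕ.+-assoc s 1) (oneTo (suc n))) (List.map-∘ (oneTo (suc n)))) ⟩
  map (s ℕ.+_) (1 ∷ map suc (oneTo (suc n)))
    ≡⟨ cong (map (s ℕ.+_)) (oneTo-suc (suc n)) ⟨
  map (s ℕ.+_) (oneTo (suc (suc n))) ∎

≥ᶜ-hook : ∀ n x β → (β ≥ᶜ (replicate n 1 ++ x ∷ [])) ≡ descentsWithin 0 n β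
≥ᶜ-hook n x β = trans (cong (λ L → and (map (λ d → memb d L) (𝒟 β))) 𝒟-hook) (and-descentsFrom 0 n β)
  where
  𝒟-hook : 𝒟 (replicate n 1 ++ x ∷ []) ≡ oneTo n
  𝒟-hook = trans (descentsFrom-hook 0 n x) (List.map-id (oneTo n))

descentsWithin-shift : ∀ s n β → All (0 <_) β → descentsWithin (suc s) (suc n) β ≡ descentsWithin s n β
descentsWithin-shift s n []              _           = refl
descentsWithin-shift s n (a ∷ [])        _           = refl
descentsWithin-shift s n (suc a ∷ b ∷ r) (_ ∷ pos) = cong₂ _∧_
  (begin
    memb (suc s ℕ.+ suc a) (oneTo (suc n))   ≡⟨ cong (λ d → memb (suc d) (oneTo (suc n))) (ℕ.+-suc s a) ⟩
    memb (suc (suc (s ℕ.+ a))) (oneTo (suc n)) ≡⟨ memb-oneTo-suc (s ℕ.+ a) n ⟩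
    memb (suc (s ℕ.+ a)) (oneTo n)           ≡⟨ cong (λ d → memb d (oneTo n)) (ℕ.+-suc s a) ⟨
    memb (s ℕ.+ suc a) (oneTo n)             ∎)
  (descentsWithin-shift (s ℕ.+ suc a) n (b ∷ r) pos)

descentsWithin-incHead : ∀ n a r → All (0 <_) (a ∷ r) → descentsWithin 0 (suc n) (suc a ∷ r) ≡ descentsWithin 0 n (a ∷ r)
descentsWithin-incHead n a []      _   = refl
descentsWithin-incHead n a (b ∷ r) pos = descentsWithin-shift 0 n (a ∷ b ∷ r) pos

descentsWithin-length : ∀ s n β → All (0 <_) β → s ≤ n → descentsWithin s n β ≡ true → s ℕ.+ length β ≤ suc n
descentsWithin-length s n []          _            s≤n _ = ℕ.≤-trans (ℕ.≤-reflexive (ℕ.+-identityʳ s)) (ℕ.m≤n⇒m≤1+n s≤n)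
descentsWithin-length s n (a ∷ [])    _            s≤n _ = ℕ.≤-trans (ℕ.≤-reflexive (ℕ.+-comm s 1)) (s≤s s≤n)
descentsWithin-length s n (a ∷ b ∷ r) (0<a ∷ pos) s≤n eq with memb (s ℕ.+ a) (oneTo n) in m
... | true = ℕ.≤-trans (ℕ.≤-reflexive (ℕ.+-suc s L))
  (ℕ.≤-trans (ℕ.+-monoˡ-≤ L (ℕ.≤-trans (ℕ.≤-reflexive (ℕ.+-comm 1 s)) (ℕ.+-monoʳ-≤ s 0<a)))
             (descentsWithin-length (s ℕ.+ a) n (b ∷ r) pos (memb-oneTo⇒≤ (s ℕ.+ a) n m) eq))
  where L = length (b ∷ r)

ribbonSum : ℕ → ℕ → (List ℕ → ℚ) → ℚ
ribbonSum n K F = sumOver (compositions K) λ β →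
  if descentsWithin 0 n β then negOnePow (suc n ∸ length β) * F β else 0ℚ

ribbonSum-suc : ∀ n K F →
  ribbonSum (suc n) (suc (suc K)) F ≡ ribbonSum n (suc K) (λ β → F (1 ∷ β)) - ribbonSum n (suc K) (λ β → F (incHead β))
ribbonSum-suc n K F = begin
  ribbonSum (suc n) (suc (suc K)) F
    ≡⟨ sumOver-compositions K term ⟩
  sumOver C (λ β → term (1 ∷ β)) + sumOver C (λ β → term (incHead β))
    ≡⟨ cong₂ _+_ (sumOver-congᴬ (compositions-isComposition K) term-1∷)
                 (trans (sumOver-congᴬ (compositions-isComposition K) term-incHead) (sumOver-neg C _)) ⟩
  ribbonSum n (suc K) (λ β → F (1 ∷ β)) - ribbonSum n (suc K) (λ β → F (incHead β)) ∎
  where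
  C = compositions (suc K)
  term : List ℕ → ℚ
  term β = if descentsWithin 0 (suc n) β then negOnePow (suc (suc n) ∸ length β) * F β else 0ℚ
  term-1∷ : ∀ β → IsComposition β → term (1 ∷ β)
    ≡ (if descentsWithin 0 n β then negOnePow (suc n ∸ length β) * F (1 ∷ β) else 0ℚ)
  term-1∷ (b ∷ r) (pos , _) =
    cong (λ c → if c then negOnePow (suc n ∸ length (b ∷ r)) * F (1 ∷ b ∷ r) else 0ℚ) (descentsWithin-shift 0 n (b ∷ r) pos)
  term-incHead : ∀ β → IsComposition β → term (incHead β)
    ≡ - (if descentsWithin 0 n β then negOnePow (suc n ∸ length β) * F (incHead β) else 0ℚ)
  term-incHead (a ∷ r) (pos , _) with descentsWithin 0 n (a ∷ r) in within
  ... | false = cong (λ c → if c then X else 0ℚ) (trans (descentsWithin-incHead n a r pos) within)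
    where X = negOnePow (suc (suc n) ∸ length (a ∷ r)) * F (suc a ∷ r)
  ... | true  = begin
    term (suc a ∷ r)
      ≡⟨ cong (λ c → if c then X else 0ℚ) (trans (descentsWithin-incHead n a r pos) within) ⟩
    negOnePow (suc (suc n) ∸ length (a ∷ r)) * F (suc a ∷ r)
      ≡⟨ cong (λ e → negOnePow e * F (suc a ∷ r)) (ℕ.+-∸-assoc 1 ℓ≤) ⟩
    - negOnePow (suc n ∸ length (a ∷ r)) * F (suc a ∷ r)
      ≡⟨ ℚ.neg-distribˡ-* (negOnePow (suc n ∸ length (a ∷ r))) (F (suc a ∷ r)) ⟨
    - (negOnePow (suc n ∸ length (a ∷ r)) * F (suc a ∷ r)) ∎
    where
    X = negOnePow (suc (suc n) ∸ length (a ∷ r)) * F (suc a ∷ r)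
    ℓ≤ = descentsWithin-length 0 n (a ∷ r) pos z≤n within

ribbonSum-zero : ∀ K F → ribbonSum 0 (suc K) F ≡ F (suc K ∷ [])
ribbonSum-zero zero    F = trans (ℚ.+-identityʳ _) (ℚ.*-identityˡ _)
ribbonSum-zero (suc K) F = begin
  ribbonSum 0 (suc (suc K)) F
    ≡⟨ sumOver-compositions K term ⟩
  sumOver C (λ β → term (1 ∷ β)) + sumOver C (λ β → term (incHead β))
    ≡⟨ cong₂ _+_ (trans (sumOver-congᴬ (compositions-isComposition K) (λ { (b ∷ r) _ → refl })) (sumOver-zero C (λ _ → refl)))
                 (sumOver-congᴬ (compositions-isComposition K) λ { (a ∷ []) _ → refl ; (a ∷ b ∷ r) _ → refl }) ⟩
  0ℚ + ribbonSum 0 (suc K) (λ β → F (incHead β))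
    ≡⟨ trans (ℚ.+-identityˡ _) (ribbonSum-zero K (λ β → F (incHead β))) ⟩
  F (suc (suc K) ∷ []) ∎
  where
  C = compositions (suc K)
  term : List ℕ → ℚ
  term β = if descentsWithin 0 0 β then negOnePow (1 ∸ length β) * F β else 0ℚ

incHeadℤ : List ℤ → List ℤ
incHeadℤ []      = []
incHeadℤ (x ∷ w) = ℤ.suc x ∷ w

ribbonAt-incHead : ∀ n a K f → ribbonAt n a K (λ w → f (incHeadℤ w)) ≡ ribbonAt n (suc a) (suc K) f
ribbonAt-incHead zero    a K f = refl
ribbonAt-incHead (suc n) a K f = cong (_-_ (ribbonAt n 1 (K ∸ a) (λ w → f (+ suc a ∷ w)))) (ribbonAt-incHead n (suc a) K f)

ribbonSum-ribbonAt : ∀ n K f → n < K → ribbonSum n K (λ β → f (map +_ β)) ≡ ribbonAt n 1 K f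
ribbonSum-ribbonAt zero    (suc K)       f _         = ribbonSum-zero K _
ribbonSum-ribbonAt (suc n) (suc (suc K)) f (s≤s n<K) = begin
  ribbonSum (suc n) (suc (suc K)) (λ β → f (map +_ β))
    ≡⟨ ribbonSum-suc n K _ ⟩
  ribbonSum n (suc K) (λ β → f (+ 1 ∷ map +_ β)) - ribbonSum n (suc K) (λ β → f (map +_ (incHead β)))
    ≡⟨ cong₂ _-_ (ribbonSum-ribbonAt n (suc K) (λ w → f (+ 1 ∷ w)) n<K) (begin
         ribbonSum n (suc K) (λ β → f (map +_ (incHead β)))
           ≡⟨ sumOver-cong (compositions (suc K)) (λ β →
                cong (λ w → if descentsWithin 0 n β then negOnePow (suc n ∸ length β) * f w else 0ℚ) (map-incHead β)) ⟩
         ribbonSum n (suc K) (λ β → f (incHeadℤ (map +_ β)))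
           ≡⟨ ribbonSum-ribbonAt n (suc K) (λ w → f (incHeadℤ w)) n<K ⟩
         ribbonAt n 1 (suc K) (λ w → f (incHeadℤ w))
           ≡⟨ ribbonAt-incHead n 1 (suc K) f ⟩
         ribbonAt n 2 (suc (suc K)) f ∎) ⟩
  ribbonAt (suc n) 1 (suc (suc K)) f ∎
  where
  map-incHead : ∀ β → map +_ (incHead β) ≡ incHeadℤ (map +_ β)
  map-incHead []      = refl
  map-incHead (a ∷ r) = refl

-- the composition (1^n, k − n) as written in the theorem, where n = j − 1
hook : ℕ → ℕ → List ℕ
hook n k = replicate n 1 ++ (k ∸ suc n) ℕ.+ 1 ∷ []

pair-R-hook : ∀ n k f → suc n ≤ k → pair (R (hook n k)) f ≡ ribbonAt n 1 k f
pair-R-hook n k f n<k = begin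
  pair (R α) f
    ≡⟨ pair-sumN (map term (filterᵇ (_≥ᶜ α) (compositions (sumℕ α)))) f ⟩
  sumOver (map term (filterᵇ (_≥ᶜ α) (compositions (sumℕ α)))) (λ y → pair y f)
    ≡⟨ sumOver-map term (filterᵇ (_≥ᶜ α) (compositions (sumℕ α))) _ ⟩
  sumOver (filterᵇ (_≥ᶜ α) (compositions (sumℕ α))) (λ β → pair (term β) f)
    ≡⟨ sumOver-filter (_≥ᶜ α) (compositions (sumℕ α)) _ ⟩
  sumOver (compositions (sumℕ α)) (λ β → if β ≥ᶜ α then pair (term β) f else 0ℚ)
    ≡⟨ cong (λ K → sumOver (compositions K) (λ β → if β ≥ᶜ α then pair (term β) f else 0ℚ)) ∣α∣ ⟩
  sumOver (compositions k) (λ β → if β ≥ᶜ α then pair (term β) f else 0ℚ)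
    ≡⟨ sumOver-cong (compositions k) (λ β → cong₂ (λ c y → if c then y else 0ℚ) (≥ᶜ-hook n x β)
         (trans (pair-scale (negOnePow (length α ∸ length β)) (Hw β) f)
                (cong₂ (λ ℓ y → negOnePow (ℓ ∸ length β) * y) (ℓα n) (pair-Hw β f)))) ⟩
  ribbonSum n k (λ β → f (map +_ β))
    ≡⟨ ribbonSum-ribbonAt n k f n<k ⟩
  ribbonAt n 1 k f ∎
  where
  x = (k ∸ suc n) ℕ.+ 1
  α = hook n k
  term : List ℕ → NSym
  term β = scale (negOnePow (length α ∸ length β)) (Hw β)
  ℓα : ∀ n → length (replicate n 1 ++ x ∷ []) ≡ suc n
  ℓα zero    = refl
  ℓα (suc n) = cong suc (ℓα n)
  sum-hook : ∀ n → sumℕ (replicate n 1 ++ x ∷ []) ≡ n ℕ.+ x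
  sum-hook zero    = ℕ.+-identityʳ x
  sum-hook (suc n) = cong suc (sum-hook n)
  ∣α∣ : sumℕ α ≡ k
  ∣α∣ = trans (sum-hook n) (trans (cong (n ℕ.+_) (ℕ.+-comm (k ∸ suc n) 1)) (trans (ℕ.+-suc n (k ∸ suc n)) (ℕ.m+[n∸m]≡n n<k)))

-- Sums of 𝔖_β over compositions

run : ℤ → ℕ → Combo ℤ
run s n = concatTo n (λ b → letter (s ℤ.+ + b))

pair-run : ∀ s n g → pair (run s n) g ≡ sumTo n (λ b → g (s ℤ.+ + b))
pair-run s n g = trans (pair-concatTo n _ g) (sumTo-cong n (λ b _ → pair-letter (s ℤ.+ + b) g))

run-cong : ∀ {s s′} n → s ≡ s′ → run s n ≐ run s′ n
run-cong n refl g = refl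

pair-run-telescope : ∀ s n g → pair (run s n) g - pair (run (ℤ.suc s) n) g ≡ g s - g (s ℤ.+ + n)
pair-run-telescope s n g = begin
  pair (run s n) g - pair (run (ℤ.suc s) n) g
    ≡⟨ cong₂ _-_ (pair-run s n g) (trans (pair-run (ℤ.suc s) n g) (sumTo-cong n (λ b _ → cong g (shift b)))) ⟩
  sumTo n (λ b → g (s ℤ.+ + b)) - sumTo n (λ b → g (s ℤ.+ + suc b))
    ≡⟨ trans (cong (_+_ (sumTo n (λ b → g (s ℤ.+ + b)))) (sym (sumTo-neg n (λ b → g (s ℤ.+ + suc b)))))
             (sym (sumTo-distrib n (λ b → g (s ℤ.+ + b)) (λ b → - g (s ℤ.+ + suc b)))) ⟩
  sumTo n (λ b → g (s ℤ.+ + b) - g (s ℤ.+ + suc b))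
    ≡⟨ sumTo-telescope n (λ b → g (s ℤ.+ + b)) ⟩
  g (s ℤ.+ + 0) - g (s ℤ.+ + n)
    ≡⟨ cong (λ z → g z - g (s ℤ.+ + n)) (ℤ.+-identityʳ s) ⟩
  g s - g (s ℤ.+ + n) ∎
  where
  shift : ∀ b → ℤ.suc s ℤ.+ + b ≡ s ℤ.+ + suc b
  shift b = solve 2 (λ s b → (con (+ 1) :+ s) :+ b := s :+ (con (+ 1) :+ b)) refl s (+ b)
    where open ℤ-Solver.+-*-Solver

pair-run-single : ∀ a n K (g : ℤ → ℚ) → (∀ x → x ≢ K → g (+ x) ≡ 0ℚ) → a ≤ K → K < a ℕ.+ n →
  pair (run (+ a) n) g ≡ g (+ K)
pair-run-single a n K g g≡0 a≤K K<a+n = begin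
  pair (run (+ a) n) g             ≡⟨ pair-run (+ a) n g ⟩
  sumTo n (λ b → g (+ (a ℕ.+ b)))  ≡⟨ sumTo-single n (K ∸ a) _ K∸a<n
                                        (λ b b≢ → g≡0 (a ℕ.+ b) (λ eq → b≢ (trans (sym (ℕ.m+n∸m≡n a b)) (cong (_∸ a) eq)))) ⟩
  g (+ (a ℕ.+ (K ∸ a)))            ≡⟨ cong (λ x → g (+ x)) (ℕ.m+[n∸m]≡n a≤K) ⟩
  g (+ K)                          ∎
  where
  K∸a<n : K ∸ a < n
  K∸a<n = ℕ.<-≤-trans (ℕ.∸-monoˡ-< K<a+n a≤K) (ℕ.≤-reflexive (ℕ.m+n∸m≡n a n))

boxMatrix : ℕ → ℕ → ℕ → Matrix
boxMatrix a n N zero    c = run (+ a ℤ.+ + c) n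
boxMatrix a n N (suc i) c = run (+ suc c ℤ.- + suc i) N

minor0-boxMatrix : ∀ a n N i c → minor 0 (boxMatrix a n N) i c ≐ boxMatrix 1 N N i c
minor0-boxMatrix a n N zero    c = run-cong {+ suc (suc c) ℤ.- + 1} N refl
minor0-boxMatrix a n N (suc i) c = run-cong N ([1+m]-[1+n]≡m-n (suc c) (suc i))

minor1-boxMatrix : ∀ a n N i c → minor 1 (boxMatrix a n N) i c ≐ boxMatrix (suc a) n N i c
minor1-boxMatrix a n N zero    c = run-cong n (cong +_ (ℕ.+-suc a c))
minor1-boxMatrix a n N (suc i) c = run-cong N ([1+m]-[1+n]≡m-n (suc c) (suc i))

module _ (m a n N K : ℕ) (f : List ℤ → ℚ) (reg : Regular f) (hom : Homogeneous K f)
         (K<a+n : K < a ℕ.+ n) (K+m<N : K ℕ.+ m < N) where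

  private
    M : Matrix
    M = boxMatrix a n N

    D : ℕ → ℤ → ℚ
    D p x = det (suc m) (minor p M) (λ w → f (insertAt p x w))

    Δ : ℕ → ℚ
    Δ p = pair (M p 0) (D p) - pair (M p 1) (D p)

    D-large : ∀ p x → K < x → D p (+ x) ≡ 0ℚ
    D-large p x K<x = det-zero (suc m) (minor p M) _ (λ w _ → vanishes-insertLarge reg hom p x w K<x)

    Δ0 : Δ 0 ≡ det (suc m) (boxMatrix 1 N N) (λ w → f (+ a ∷ w))
    Δ0 = begin
      pair (M 0 0) (D 0) - pair (M 0 1) (D 0)
        ≡⟨ cong (λ y → pair (M 0 0) (D 0) - y) (run-cong n (cong +_ (ℕ.+-suc a 0)) (D 0)) ⟩
      pair (M 0 0) (D 0) - pair (run (ℤ.suc (+ a ℤ.+ + 0)) n) (D 0)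
        ≡⟨ pair-run-telescope (+ a ℤ.+ + 0) n (D 0) ⟩
      D 0 (+ a ℤ.+ + 0) - D 0 (+ a ℤ.+ + 0 ℤ.+ + n)
        ≡⟨ cong (_-_ (D 0 (+ a ℤ.+ + 0)))
                (D-large 0 (a ℕ.+ 0 ℕ.+ n) (ℕ.<-≤-trans K<a+n (ℕ.≤-reflexive (cong (ℕ._+ n) (sym (ℕ.+-identityʳ a)))))) ⟩
      D 0 (+ a ℤ.+ + 0) - 0ℚ
        ≡⟨ ℚ.+-identityʳ _ ⟩
      D 0 (+ a ℤ.+ + 0)
        ≡⟨ det-cong (suc m) {minor 0 M} {boxMatrix 1 N N} (λ i c _ → minor0-boxMatrix a n N i c)
                    (λ w _ → cong (λ z → f (+ z ∷ w)) (ℕ.+-identityʳ a)) ⟩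
      det (suc m) (boxMatrix 1 N N) (λ w → f (+ a ∷ w)) ∎

    Δ1 : Δ 1 ≡ det (suc m) (boxMatrix (suc a) n N) f
    Δ1 = begin
      Δ 1                    ≡⟨ pair-run-telescope 0ℤ N (D 1) ⟩
      D 1 0ℤ - D 1 (+ N)     ≡⟨ cong (_-_ (D 1 0ℤ)) (D-large 1 N (ℕ.≤-<-trans (ℕ.m≤m+n K m) K+m<N)) ⟩
      D 1 0ℤ - 0ℚ            ≡⟨ ℚ.+-identityʳ _ ⟩
      D 1 0ℤ                 ≡⟨ det-cong (suc m) {minor 1 M} {boxMatrix (suc a) n N} (λ i c _ → minor1-boxMatrix a n N i c)
                                         (λ w _ → ignores-zero reg 1 w) ⟩
      det (suc m) (boxMatrix (suc a) n N) f ∎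

    -- row i + 2 telescopes to a negative letter and to the letter N − i − 1, which exceeds the degree
    Δ-rest : ∀ i → i < m → Δ (suc (suc i)) ≡ 0ℚ
    Δ-rest i i<m = begin
      Δ (suc (suc i))
        ≡⟨ cong (λ y → pair (M (suc (suc i)) 0) (D (suc (suc i))) - y)
                (run-cong N (sym (suc-[m-n] 1 (suc (suc i)))) (D (suc (suc i)))) ⟩
      pair (M (suc (suc i)) 0) (D (suc (suc i))) - pair (run (ℤ.suc (+ 1 ℤ.- + suc (suc i))) N) (D (suc (suc i)))
        ≡⟨ pair-run-telescope (+ 1 ℤ.- + suc (suc i)) N (D (suc (suc i))) ⟩
      D (suc (suc i)) -[1+ i ] - D (suc (suc i)) (-[1+ i ] ℤ.+ + N)
        ≡⟨ cong₂ _-_ (det-zero (suc m) (minor (suc (suc i)) M) _ (λ w _ → vanishes-insertNegative reg (suc (suc i)) i w))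
                     (trans (cong (D (suc (suc i))) far-end) (D-large (suc (suc i)) (N ∸ suc i) K<N∸1+i)) ⟩
      0ℚ - 0ℚ
        ≡⟨ ℚ.+-inverseʳ 0ℚ ⟩
      0ℚ ∎
      where
      1+i≤N : suc i ≤ N
      1+i≤N = ℕ.≤-trans i<m (ℕ.≤-trans (ℕ.m≤n+m m K) (ℕ.<⇒≤ K+m<N))
      far-end : -[1+ i ] ℤ.+ + N ≡ + (N ∸ suc i)
      far-end = ℤ.⊖-≥ 1+i≤N
      K<N∸1+i : K < N ∸ suc i
      K<N∸1+i = ℕ.<-≤-trans (ℕ.≤-reflexive (sym (cong suc (ℕ.m+n∸n≡m K (suc i)))))
                            (ℕ.∸-monoˡ-< (ℕ.≤-<-trans (ℕ.+-monoʳ-≤ K i<m) K+m<N) (ℕ.m≤n+m (suc i) K))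

  -- subtracting column 1 from column 0 telescopes the runs of columns 0 and 1
  det-boxMatrix-expand : det (suc (suc m)) (boxMatrix a n N) f
    ≡ det (suc m) (boxMatrix 1 N N) (λ w → f (+ a ∷ w)) - det (suc m) (boxMatrix (suc a) n N) f
  det-boxMatrix-expand = begin
    det (suc (suc m)) M f
      ≡⟨ det-subtractColumn1 m M f ⟨
    sumTo (suc (suc m)) (λ p → negOnePow p * pair (M p 0 ++ negCombo (M p 1)) (D p))
      ≡⟨ sumTo-cong (suc (suc m)) (λ p _ → cong (negOnePow p *_) (pair-++-negCombo (M p 0) (M p 1) (D p))) ⟩
    1ℚ * Δ 0 + (- 1ℚ * Δ 1 + sumTo m (λ i → negOnePow (suc (suc i)) * Δ (suc (suc i))))
      ≡⟨ cong₂ (λ x y → 1ℚ * x + (- 1ℚ * y + sumTo m (λ i → negOnePow (suc (suc i)) * Δ (suc (suc i))))) Δ0 Δ1 ⟩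
    1ℚ * X + (- 1ℚ * Y + sumTo m (λ i → negOnePow (suc (suc i)) * Δ (suc (suc i))))
      ≡⟨ cong (λ z → 1ℚ * X + (- 1ℚ * Y + z))
              (sumTo-zero m (λ i i<m → trans (cong (negOnePow (suc (suc i)) *_) (Δ-rest i i<m)) (ℚ.*-zeroʳ (negOnePow (suc (suc i)))))) ⟩
    1ℚ * X + (- 1ℚ * Y + 0ℚ)
      ≡⟨ solve 2 (λ x y → con 1ℚ :* x :+ ((:- con 1ℚ) :* y :+ con 0ℚ) := x :- y) refl X Y ⟩
    X - Y ∎
    where
    open +-*-Solver
    X = det (suc m) (boxMatrix 1 N N) (λ w → f (+ a ∷ w))
    Y = det (suc m) (boxMatrix (suc a) n N) f

-- the far ends of the runs exceed the degree, so the expansion follows the ribbon recursion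
det-boxMatrix : ∀ m a n N K f → Regular f → Homogeneous K f → a ℕ.+ m ≤ K → K < a ℕ.+ n → K ℕ.+ m < N →
  det (suc m) (boxMatrix a n N) f ≡ ribbonAt m a K f
det-boxMatrix zero a n N K f reg hom a≤K K<a+n _ = begin
  1ℚ * pair (run (+ a ℤ.+ + 0) n) (λ x → f (x ∷ [])) + 0ℚ
    ≡⟨ trans (ℚ.+-identityʳ _) (ℚ.*-identityˡ _) ⟩
  pair (run (+ a ℤ.+ + 0) n) (λ x → f (x ∷ []))
    ≡⟨ run-cong n (ℤ.+-identityʳ (+ a)) (λ x → f (x ∷ [])) ⟩
  pair (run (+ a) n) (λ x → f (x ∷ []))
    ≡⟨ pair-run-single a n K (λ x → f (x ∷ []))
         (λ x x≢K → hom (+ x ∷ []) (λ eq → x≢K (trans (sym (ℕ.+-identityʳ x)) (ℤ.+-injective eq))))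
         (ℕ.≤-trans (ℕ.m≤m+n a 0) a≤K) K<a+n ⟩
  f (+ K ∷ []) ∎
det-boxMatrix (suc m) a n N K f reg hom a+m<K K<a+n K+m<N = begin
  det (suc (suc m)) (boxMatrix a n N) f
    ≡⟨ det-boxMatrix-expand m a n N K f reg hom K<a+n (ℕ.≤-<-trans (ℕ.+-monoʳ-≤ K (ℕ.n≤1+n m)) K+m<N) ⟩
  det (suc m) (boxMatrix 1 N N) (λ w → f (+ a ∷ w)) - det (suc m) (boxMatrix (suc a) n N) f
    ≡⟨ cong₂ _-_
         (det-boxMatrix m 1 N N (K ∸ a) (λ w → f (+ a ∷ w)) (Regular-prefix a reg) (Homogeneous-prefix a a≤K hom)
           (ℕ.≤-trans (ℕ.≤-reflexive (sym (ℕ.m+n∸m≡n a (suc m)))) (ℕ.∸-monoˡ-≤ a a+m<K))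
           (s≤s (ℕ.≤-trans (ℕ.m∸n≤m K a) (ℕ.<⇒≤ K<N)))
           (ℕ.≤-<-trans (ℕ.+-monoˡ-≤ m (ℕ.m∸n≤m K a)) (ℕ.≤-<-trans (ℕ.+-monoʳ-≤ K (ℕ.n≤1+n m)) K+m<N)))
         (det-boxMatrix m (suc a) n N K f reg hom (ℕ.≤-trans (ℕ.≤-reflexive (sym (ℕ.+-suc a m))) a+m<K)
           (ℕ.m<n⇒m<1+n K<a+n) (ℕ.≤-<-trans (ℕ.+-monoʳ-≤ K (ℕ.n≤1+n m)) K+m<N)) ⟩
  ribbonAt (suc m) a K f ∎
  where
  a≤K : a ≤ K
  a≤K = ℕ.≤-trans (ℕ.m≤m+n a (suc m)) a+m<K
  K<N : K < N
  K<N = ℕ.≤-<-trans (ℕ.m≤m+n K (suc m)) K+m<N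

sumℤTo : ℕ → (ℕ → ℤ) → ℤ
sumℤTo zero    h = 0ℤ
sumℤTo (suc n) h = h 0 ℤ.+ sumℤTo n (λ i → h (suc i))

sumℤTo-punchIn : ∀ n p (h : ℕ → ℤ) → p < suc n → sumℤTo (suc n) h ≡ h p ℤ.+ sumℤTo n (λ i → h (punchIn p i))
sumℤTo-punchIn n       zero    h _         = refl
sumℤTo-punchIn (suc n) (suc p) h (s≤s p<n) = begin
  h 0 ℤ.+ sumℤTo (suc n) (λ i → h (suc i))
    ≡⟨ cong (ℤ._+_ (h 0)) (sumℤTo-punchIn n p (λ i → h (suc i)) p<n) ⟩
  h 0 ℤ.+ (h (suc p) ℤ.+ sumℤTo n (λ i → h (suc (punchIn p i))))
    ≡⟨ solve 3 (λ x y z → x :+ (y :+ z) := y :+ (x :+ z)) refl (h 0) (h (suc p)) _ ⟩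
  h (suc p) ℤ.+ (h 0 ℤ.+ sumℤTo n (λ i → h (suc (punchIn p i)))) ∎
  where open ℤ-Solver.+-*-Solver

-- every word in the expansion of a determinant with letters U i + V c has letter sum Σ U + Σ V
det-additive-vanishing : ∀ m (U V : ℕ → ℤ) (f : List ℤ → ℚ) →
  (∀ w → wordSum w ≡ sumℤTo m U ℤ.+ sumℤTo m V → f w ≡ 0ℚ) → det m (letterMatrix (λ i c → U i ℤ.+ V c)) f ≡ 0ℚ
det-additive-vanishing zero    U V f f≡0 = f≡0 [] refl
det-additive-vanishing (suc m) U V f f≡0 = sumTo-zero (suc m) λ p p<m →
  trans (cong (negOnePow p *_) (trans (pair-letter (U p ℤ.+ V 0) (λ x → det m (minor p L) (λ w → f (insertAt p x w))))
          (det-additive-vanishing m (λ i → U (punchIn p i)) (λ c → V (suc c)) (λ w → f (insertAt p (U p ℤ.+ V 0) w))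
            (λ w eq → f≡0 _ (sum-insert p p<m w eq)))))
        (ℚ.*-zeroʳ (negOnePow p))
  where
  open ℤ-Solver.+-*-Solver
  L = letterMatrix (λ i c → U i ℤ.+ V c)
  sum-insert : ∀ p → p < suc m → ∀ w → wordSum w ≡ sumℤTo m (λ i → U (punchIn p i)) ℤ.+ sumℤTo m (λ c → V (suc c)) →
    wordSum (insertAt p (U p ℤ.+ V 0) w) ≡ sumℤTo (suc m) U ℤ.+ sumℤTo (suc m) V
  sum-insert p p<m w eq = begin
    wordSum (insertAt p (U p ℤ.+ V 0) w)   ≡⟨ wordSum-insertAt p _ w ⟩
    (U p ℤ.+ V 0) ℤ.+ wordSum w            ≡⟨ cong (ℤ._+_ (U p ℤ.+ V 0)) eq ⟩
    (U p ℤ.+ V 0) ℤ.+ (sumℤTo m (λ i → U (punchIn p i)) ℤ.+ sumℤTo m (λ c → V (suc c)))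
      ≡⟨ solve 4 (λ a b c d → (a :+ b) :+ (c :+ d) := (a :+ c) :+ (b :+ d)) refl (U p) (V 0) _ _ ⟩
    (U p ℤ.+ sumℤTo m (λ i → U (punchIn p i))) ℤ.+ sumℤTo (suc m) V
      ≡⟨ cong (ℤ._+ sumℤTo (suc m) V) (sumℤTo-punchIn m p U p<m) ⟨
    sumℤTo (suc m) U ℤ.+ sumℤTo (suc m) V  ∎

sumℤTo-sub : ∀ n (A B : ℕ → ℤ) → sumℤTo n (λ i → A i ℤ.- B i) ℤ.+ sumℤTo n B ≡ sumℤTo n A
sumℤTo-sub zero    A B = refl
sumℤTo-sub (suc n) A B = begin
  (A 0 ℤ.- B 0 ℤ.+ S) ℤ.+ (B 0 ℤ.+ T)
    ≡⟨ solve 4 (λ a b s t → (a :- b :+ s) :+ (b :+ t) := a :+ (s :+ t)) refl (A 0) (B 0) S T ⟩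
  A 0 ℤ.+ (S ℤ.+ T)
    ≡⟨ cong (ℤ._+_ (A 0)) (sumℤTo-sub n (λ i → A (suc i)) (λ i → B (suc i))) ⟩
  A 0 ℤ.+ sumℤTo n (λ i → A (suc i)) ∎
  where
  open ℤ-Solver.+-*-Solver
  S = sumℤTo n (λ i → A (suc i) ℤ.- B (suc i))
  T = sumℤTo n (λ i → B (suc i))

sumℤTo-lookup : ∀ β → sumℤTo (length β) (λ i → + lookupOr 0 β i) ≡ + sumℕ β
sumℤTo-lookup []      = refl
sumℤTo-lookup (b ∷ β) = cong (ℤ._+_ (+ b)) (sumℤTo-lookup β)

pair-𝔖-vanishing : ∀ β f K → Homogeneous K f → sumℕ β ≢ K → pair (𝔖 (map +_ β)) f ≡ 0ℚ
pair-𝔖-vanishing β f K hom ∣β∣≢K = begin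
  pair (𝔖 (map +_ β)) f
    ≡⟨ pair-𝔖 (map +_ β) f ⟩
  det (length (map +_ β)) (letterMatrix (𝔖-letter (map +_ β))) f
    ≡⟨ cong (λ n → det n (letterMatrix (𝔖-letter (map +_ β))) f) (List.length-map +_ β) ⟩
  det (length β) (letterMatrix (𝔖-letter (map +_ β))) f
    ≡⟨ det-cong (length β) (λ i c _ → letter-cong (split i c)) (λ _ _ → refl) ⟩
  det (length β) (letterMatrix (λ i c → U i ℤ.+ + c)) f
    ≡⟨ det-additive-vanishing (length β) U (λ c → + c) f (λ w eq → hom w (λ eqK → ∣β∣≢K (ℤ.+-injective (degree w eq eqK)))) ⟩
  0ℚ ∎
  where
  U : ℕ → ℤ
  U i = + lookupOr 0 β i ℤ.- + i
  split : ∀ i c → 𝔖-letter (map +_ β) i c ≡ U i ℤ.+ + c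
  split i c = begin
    lookupOr (+ 0) (map +_ β) i ℤ.+ (+ c ℤ.- + i)
      ≡⟨ cong (ℤ._+ (+ c ℤ.- + i)) (lookupOr-map +_ 0 β i) ⟩
    + lookupOr 0 β i ℤ.+ (+ c ℤ.- + i)
      ≡⟨ solve 3 (λ b c i → b :+ (c :- i) := (b :- i) :+ c) refl (+ lookupOr 0 β i) (+ c) (+ i) ⟩
    U i ℤ.+ + c ∎
    where open ℤ-Solver.+-*-Solver
  degree : ∀ w → wordSum w ≡ sumℤTo (length β) U ℤ.+ sumℤTo (length β) (λ c → + c) → wordSum w ≡ + K → + sumℕ β ≡ + K
  degree w eq eqK = begin
    + sumℕ β                                              ≡⟨ sumℤTo-lookup β ⟨
    sumℤTo (length β) (λ i → + lookupOr 0 β i)            ≡⟨ sumℤTo-sub (length β) (λ i → + lookupOr 0 β i) (λ i → + i) ⟨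
    sumℤTo (length β) U ℤ.+ sumℤTo (length β) (λ i → + i) ≡⟨ eq ⟨
    wordSum w                                             ≡⟨ eqK ⟩
    + K                                                   ∎

boxSum : ℕ → ℕ → (List ℕ → ℚ) → ℚ
boxSum N zero    G = G []
boxSum N (suc d) G = sumTo N (λ b → boxSum N d (λ β → G (suc b ∷ β)))

boxSum-cong : ∀ N d {G G′ : List ℕ → ℚ} → (∀ β → length β ≡ d → G β ≡ G′ β) → boxSum N d G ≡ boxSum N d G′
boxSum-cong N zero    eq = eq [] refl
boxSum-cong N (suc d) eq = sumTo-cong N (λ b _ → boxSum-cong N d (λ β ∣β∣ → eq (suc b ∷ β) (cong suc ∣β∣)))

boxSum-zero : ∀ N d {G : List ℕ → ℚ} → (∀ β → G β ≡ 0ℚ) → boxSum N d G ≡ 0ℚ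
boxSum-zero N zero    eq = eq []
boxSum-zero N (suc d) eq = sumTo-zero N (λ b _ → boxSum-zero N d (λ β → eq (suc b ∷ β)))

boxSum-sumTo : ∀ N d n (G : ℕ → List ℕ → ℚ) →
  boxSum N d (λ β → sumTo n (λ b → G b β)) ≡ sumTo n (λ b → boxSum N d (G b))
boxSum-sumTo N zero    n G = refl
boxSum-sumTo N (suc d) n G =
  trans (sumTo-cong N (λ b′ _ → boxSum-sumTo N d n (λ b β → G b (suc b′ ∷ β)))) (sumTo-swap N n _)

sumOver-compositions-head : ∀ K (G : List ℕ → ℚ) →
  sumOver (compositions (suc K)) G ≡ sumTo (suc K) (λ b → sumOver (compositions (K ∸ b)) (λ γ → G (suc b ∷ γ)))
sumOver-compositions-head zero    G = sym (ℚ.+-identityʳ _)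
sumOver-compositions-head (suc K) G =
  trans (sumOver-compositions K G)
        (cong (_+_ (sumOver (compositions (suc K)) (λ β → G (1 ∷ β)))) (sumOver-compositions-head K (λ β → G (incHead β))))

-- both sides sum G over the β ∈ {1, …, N}^j with |β| = K
compositions-boxSum : ∀ j K N (G : List ℕ → ℚ) → K ≤ N →
  sumOver (compositions K) (λ β → if ⌊ length β ℕ.≟ j ⌋ then G β else 0ℚ)
    ≡ boxSum N j (λ β → if ⌊ sumℕ β ℕ.≟ K ⌋ then G β else 0ℚ)
compositions-boxSum zero    zero    N G _   = ℚ.+-identityʳ _
compositions-boxSum zero    (suc K) N G _   =
  trans (sumOver-compositions-head K _) (sumTo-zero (suc K) (λ b _ → sumOver-zero (compositions (K ∸ b)) (λ _ → refl)))
compositions-boxSum (suc j) zero    N G _   =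
  trans (ℚ.+-identityʳ _) (sym (sumTo-zero N (λ b _ → boxSum-zero N j (λ _ → refl))))
compositions-boxSum (suc j) (suc K) N G K<N = begin
  sumOver (compositions (suc K)) (λ β → if ⌊ length β ℕ.≟ suc j ⌋ then G β else 0ℚ)
    ≡⟨ sumOver-compositions-head K _ ⟩
  sumTo (suc K) (λ b → sumOver (compositions (K ∸ b)) (λ γ → if ⌊ suc (length γ) ℕ.≟ suc j ⌋ then G (suc b ∷ γ) else 0ℚ))
    ≡⟨ sumTo-cong (suc K) (λ b b≤K → begin
         sumOver (compositions (K ∸ b)) (λ γ → if ⌊ suc (length γ) ℕ.≟ suc j ⌋ then G (suc b ∷ γ) else 0ℚ)
           ≡⟨ sumOver-cong (compositions (K ∸ b)) (λ γ →
                if-cong (G (suc b ∷ γ)) (⌊⌋-⇔ (mk⇔ ℕ.suc-injective (cong suc)) _ _)) ⟩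
         sumOver (compositions (K ∸ b)) (λ γ → if ⌊ length γ ℕ.≟ j ⌋ then G (suc b ∷ γ) else 0ℚ)
           ≡⟨ compositions-boxSum j (K ∸ b) N (λ γ → G (suc b ∷ γ)) (ℕ.≤-trans (ℕ.m∸n≤m K b) (ℕ.<⇒≤ K<N)) ⟩
         boxSum N j (λ γ → if ⌊ sumℕ γ ℕ.≟ K ∸ b ⌋ then G (suc b ∷ γ) else 0ℚ)
           ≡⟨ boxSum-cong N j (λ γ _ → if-cong (G (suc b ∷ γ)) (⌊⌋-⇔ (mk⇔ (fwd b (ℕ.s≤s⁻¹ b≤K) γ) (bwd b γ)) _ _)) ⟩
         H b ∎) ⟩
  sumTo (suc K) H
    ≡⟨ sumTo-extend (suc K) N H K<N (λ b K<b _ →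
         boxSum-zero N j (λ γ → if-false (G (suc b ∷ γ)) (⌊⌋-false _ (too-big b γ K<b)))) ⟩
  sumTo N H ∎
  where
  if-cong : ∀ {c c′ : Bool} (x : ℚ) → c ≡ c′ → (if c then x else 0ℚ) ≡ (if c′ then x else 0ℚ)
  if-cong x refl = refl
  if-false : ∀ {c : Bool} (x : ℚ) → c ≡ false → (if c then x else 0ℚ) ≡ 0ℚ
  if-false x refl = refl
  H : ℕ → ℚ
  H b = boxSum N j (λ γ → if ⌊ suc b ℕ.+ sumℕ γ ℕ.≟ suc K ⌋ then G (suc b ∷ γ) else 0ℚ)
  fwd : ∀ b → b ≤ K → ∀ γ → sumℕ γ ≡ K ∸ b → suc b ℕ.+ sumℕ γ ≡ suc K
  fwd b b≤K γ eq = cong suc (trans (cong (b ℕ.+_) eq) (ℕ.m+[n∸m]≡n b≤K))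
  bwd : ∀ b γ → suc b ℕ.+ sumℕ γ ≡ suc K → sumℕ γ ≡ K ∸ b
  bwd b γ eq = trans (sym (ℕ.m+n∸m≡n b (sumℕ γ))) (cong (_∸ b) (ℕ.suc-injective eq))
  too-big : ∀ b γ → suc K ≤ b → suc b ℕ.+ sumℕ γ ≢ suc K
  too-big b γ K<b eq = ℕ.<-irrefl (sym eq) (s≤s (ℕ.≤-trans K<b (ℕ.m≤m+n b (sumℕ γ))))

-- interpolates between the matrix of 𝔖_β (t = 0) and boxMatrix 1 N N (t = length β)
mixedMatrix : ℕ → ℕ → List ℕ → Matrix
mixedMatrix N t β i c with i ℕ.<? t
... | yes _ = boxMatrix 1 N N i c
... | no  _ = letter (+ lookupOr 0 β (i ∸ t) ℤ.+ (+ c ℤ.- + i))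

mixedMatrix-other : ∀ N t b β i c → i ≢ t → mixedMatrix N t (suc b ∷ β) i c ≐ mixedMatrix N (suc t) β i c
mixedMatrix-other N t b β i c i≢t with i ℕ.<? t | i ℕ.<? suc t
... | yes _   | yes _    = λ g → refl
... | yes i<t | no  i≮t′ = ⊥-elim (i≮t′ (ℕ.m<n⇒m<1+n i<t))
... | no  i≮t | yes i<t′ = ⊥-elim (i≢t (ℕ.≤-antisym (ℕ.s≤s⁻¹ i<t′) (ℕ.≮⇒≥ i≮t)))
... | no  i≮t | no  _    =
  letter-cong (cong (λ d → + lookupOr 0 (suc b ∷ β) d ℤ.+ (+ c ℤ.- + i)) (i∸t i (ℕ.≤∧≢⇒< (ℕ.≮⇒≥ i≮t) (i≢t ∘′ sym))))
  where
  i∸t : ∀ i → t < i → i ∸ t ≡ suc (i ∸ suc t)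
  i∸t (suc i) (s≤s t≤i) = ℕ.+-∸-assoc 1 t≤i

mixedMatrix-pivot : ∀ N t b β c → mixedMatrix N t (suc b ∷ β) t c ≡ letter (+ suc b ℤ.+ (+ c ℤ.- + t))
mixedMatrix-pivot N t b β c with t ℕ.<? t
... | yes t<t = ⊥-elim (ℕ.<-irrefl refl t<t)
... | no  _   = cong (λ d → letter (+ lookupOr 0 (suc b ∷ β) d ℤ.+ (+ c ℤ.- + t))) (ℕ.n∸n≡0 t)

mixedMatrix-row : ∀ N t β c → mixedMatrix N (suc t) β t c ≐ concatTo N (λ b → mixedMatrix N t (suc b ∷ β) t c)
mixedMatrix-row N t β c g with t ℕ.<? suc t
... | no  t≮1+t = ⊥-elim (t≮1+t (ℕ.n<1+n t))
... | yes _     = begin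
  pair (boxMatrix 1 N N t c) g                                  ≡⟨ cong (λ e → pair e g) (box-run t) ⟩
  pair (run (start t) N) g                                      ≡⟨ pair-run (start t) N g ⟩
  sumTo N (λ b → g (start t ℤ.+ + b))                           ≡⟨ sumTo-cong N (λ b _ → cong g (start-+ t b)) ⟩
  sumTo N (λ b → g (+ suc b ℤ.+ (+ c ℤ.- + t)))                 ≡⟨ sumTo-cong N (λ b _ → pair-letter _ g) ⟨
  sumTo N (λ b → pair (letter (+ suc b ℤ.+ (+ c ℤ.- + t))) g)
    ≡⟨ sumTo-cong N (λ b _ → cong (λ e → pair e g) (mixedMatrix-pivot N t b β c)) ⟨
  sumTo N (λ b → pair (mixedMatrix N t (suc b ∷ β) t c) g)      ≡⟨ pair-concatTo N _ g ⟨
  pair (concatTo N (λ b → mixedMatrix N t (suc b ∷ β) t c)) g   ∎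
  where
  open ℤ-Solver.+-*-Solver
  start : ℕ → ℤ
  start zero    = + 1 ℤ.+ + c
  start (suc t) = + suc c ℤ.- + suc t
  box-run : ∀ t → boxMatrix 1 N N t c ≡ run (start t) N
  box-run zero    = refl
  box-run (suc t) = refl
  start-+ : ∀ t b → start t ℤ.+ + b ≡ + suc b ℤ.+ (+ c ℤ.- + t)
  start-+ zero    b = solve 2 (λ c b → (con (+ 1) :+ c) :+ b := (con (+ 1) :+ b) :+ (c :- con (+ 0))) refl (+ c) (+ b)
  start-+ (suc t) b = solve 3 (λ c b t → ((con (+ 1) :+ c) :- (con (+ 1) :+ t)) :+ b := (con (+ 1) :+ b) :+ (c :- (con (+ 1) :+ t)))
                            refl (+ c) (+ b) (+ t)

mixedMatrix-all : ∀ N j i c → i < j → mixedMatrix N j [] i c ≡ boxMatrix 1 N N i c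
mixedMatrix-all N j i c i<j with i ℕ.<? j
... | yes _   = refl
... | no  i≮j = ⊥-elim (i≮j i<j)

mixedMatrix-none : ∀ N β i c → letterMatrix (𝔖-letter (map +_ β)) i c ≐ mixedMatrix N 0 β i c
mixedMatrix-none N β i c = letter-cong (cong (ℤ._+ (+ c ℤ.- + i)) (lookupOr-map +_ 0 β i))

-- summing out β one row at a time
boxSum-mixedMatrix : ∀ N j f d t → t ℕ.+ d ≡ j →
  boxSum N d (λ β → det j (mixedMatrix N t β) f) ≡ det j (mixedMatrix N j []) f
boxSum-mixedMatrix N j f zero    t t+0≡j = cong (λ t → det j (mixedMatrix N t []) f) (trans (sym (ℕ.+-identityʳ t)) t+0≡j)
boxSum-mixedMatrix N j f (suc d) t t+d≡j = begin
  sumTo N (λ b → boxSum N d (λ β → det j (mixedMatrix N t (suc b ∷ β)) f))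
    ≡⟨ boxSum-sumTo N d N (λ b β → det j (mixedMatrix N t (suc b ∷ β)) f) ⟨
  boxSum N d (λ β → sumTo N (λ b → det j (mixedMatrix N t (suc b ∷ β)) f))
    ≡⟨ boxSum-cong N d (λ β _ → det-sumRow j N t (λ b → mixedMatrix N t (suc b ∷ β)) (mixedMatrix N (suc t) β) f t<j
                                   (mixedMatrix-row N t β) (λ b i c → mixedMatrix-other N t b β i c)) ⟩
  boxSum N d (λ β → det j (mixedMatrix N (suc t) β) f)
    ≡⟨ boxSum-mixedMatrix N j f d (suc t) (trans (sym (ℕ.+-suc t d)) t+d≡j) ⟩
  det j (mixedMatrix N j []) f ∎
  where
  t<j : t < j
  t<j = ℕ.<-≤-trans (ℕ.m<m+n t (s≤s z≤n)) (ℕ.≤-reflexive t+d≡j)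

ribbonAt-vanishing : ∀ n a K f → (∀ w → wordSum w ≡ + K → f w ≡ 0ℚ) → a ℕ.+ n ≤ K → ribbonAt n a K f ≡ 0ℚ
ribbonAt-vanishing zero    a K f f≡0 _       = f≡0 (+ K ∷ []) (cong +_ (ℕ.+-identityʳ K))
ribbonAt-vanishing (suc n) a K f f≡0 a+n<K = trans (cong₂ _-_
    (ribbonAt-vanishing n 1 (K ∸ a) (λ w → f (+ a ∷ w))
      (λ w eq → f≡0 (+ a ∷ w) (trans (cong (ℤ._+_ (+ a)) eq) (cong +_ (ℕ.m+[n∸m]≡n a≤K))))
      (ℕ.≤-trans (ℕ.≤-reflexive (sym (ℕ.m+n∸m≡n a (suc n)))) (ℕ.∸-monoˡ-≤ a a+n<K)))
    (ribbonAt-vanishing n (suc a) K f f≡0 (ℕ.≤-trans (ℕ.≤-reflexive (sym (ℕ.+-suc a n))) a+n<K)))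
  (ℚ.+-inverseʳ 0ℚ)
  where
  a≤K : a ≤ K
  a≤K = ℕ.≤-trans (ℕ.m≤m+n a (suc n)) a+n<K

pair-𝔖-mixedMatrix : ∀ N β f → pair (𝔖 (map +_ β)) f ≡ det (length β) (mixedMatrix N 0 β) f
pair-𝔖-mixedMatrix N β f = begin
  pair (𝔖 (map +_ β)) f                                           ≡⟨ pair-𝔖 (map +_ β) f ⟩
  det (length (map +_ β)) (letterMatrix (𝔖-letter (map +_ β))) f
    ≡⟨ cong (λ n → det n (letterMatrix (𝔖-letter (map +_ β))) f) (List.length-map +_ β) ⟩
  det (length β) (letterMatrix (𝔖-letter (map +_ β))) f
    ≡⟨ det-cong (length β) (λ i c _ → mixedMatrix-none N β i c) (λ _ _ → refl) ⟩
  det (length β) (mixedMatrix N 0 β) f                            ∎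

-- summed over the box, the rows of 𝔖_β become runs, and the resulting box determinant is the ribbon
boxSum-𝔖 : ∀ m K f → Regular f → Homogeneous K f → suc m ≤ K →
  boxSum (K ℕ.+ suc m) (suc m) (λ β → if ⌊ sumℕ β ℕ.≟ K ⌋ then pair (𝔖 (map +_ β)) f else 0ℚ) ≡ ribbonAt m 1 K f
boxSum-𝔖 m K f reg hom m<K = begin
  boxSum N j (λ β → if ⌊ sumℕ β ℕ.≟ K ⌋ then pair (𝔖 (map +_ β)) f else 0ℚ)
    ≡⟨ boxSum-cong N j (λ β ∣β∣ → trans (if-≟-then (sumℕ β) K (pair-𝔖-vanishing β f K hom))
                                         (trans (pair-𝔖-mixedMatrix N β f) (cong (λ n → det n (mixedMatrix N 0 β) f) ∣β∣))) ⟩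
  boxSum N j (λ β → det j (mixedMatrix N 0 β) f)
    ≡⟨ boxSum-mixedMatrix N j f j 0 refl ⟩
  det j (mixedMatrix N j []) f
    ≡⟨ det-cong j {mixedMatrix N j []} {boxMatrix 1 N N} {f} {f}
                (λ i c i<j g → cong (λ e → pair e g) (mixedMatrix-all N j i c i<j)) (λ _ _ → refl) ⟩
  det j (boxMatrix 1 N N) f
    ≡⟨ det-boxMatrix m 1 N N K f reg hom m<K (s≤s (ℕ.m≤m+n K j)) (ℕ.+-monoʳ-< K (ℕ.n<1+n m)) ⟩
  ribbonAt m 1 K f ∎
  where
  j = suc m
  N = K ℕ.+ j

-- both sides vanish unless f has the degree k of the 𝔖_β
sum-𝔖-compositions : ∀ m k K f → Regular f → Homogeneous K f → suc m ≤ k →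
  sumOver (filterᵇ (λ β → ⌊ length β ℕ.≟ suc m ⌋) (compositions k)) (λ β → pair (𝔖 (map +_ β)) f) ≡ ribbonAt m 1 k f
sum-𝔖-compositions m k K f reg hom m<k = begin
  sumOver (filterᵇ (λ β → ⌊ length β ℕ.≟ suc m ⌋) (compositions k)) G
    ≡⟨ sumOver-filter _ (compositions k) G ⟩
  sumOver (compositions k) (λ β → if ⌊ length β ℕ.≟ suc m ⌋ then G β else 0ℚ)
    ≡⟨ compositions-boxSum (suc m) k (k ℕ.+ suc m) G (ℕ.m≤m+n k (suc m)) ⟩
  boxSum (k ℕ.+ suc m) (suc m) (λ β → if ⌊ sumℕ β ℕ.≟ k ⌋ then G β else 0ℚ)
    ≡⟨ by-degree (K ℕ.≟ k) ⟩
  ribbonAt m 1 k f ∎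
  where
  G : List ℕ → ℚ
  G β = pair (𝔖 (map +_ β)) f
  by-degree : Dec (K ≡ k) → boxSum (k ℕ.+ suc m) (suc m) (λ β → if ⌊ sumℕ β ℕ.≟ k ⌋ then G β else 0ℚ) ≡ ribbonAt m 1 k f
  by-degree (yes refl) = boxSum-𝔖 m K f reg hom m<k
  by-degree (no K≢k)   = begin
    boxSum (k ℕ.+ suc m) (suc m) (λ β → if ⌊ sumℕ β ℕ.≟ k ⌋ then G β else 0ℚ)
      ≡⟨ boxSum-zero (k ℕ.+ suc m) (suc m) (λ β → if-≟-else (sumℕ β) k (λ ∣β∣≡k →
           pair-𝔖-vanishing β f K hom (λ ∣β∣≡K → K≢k (trans (sym ∣β∣≡K) ∣β∣≡k)))) ⟩
    0ℚ
      ≡⟨ ribbonAt-vanishing m 1 k f (λ w eq → hom w (λ eqK → K≢k (ℤ.+-injective (trans (sym eqK) eq)))) m<k ⟨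
    ribbonAt m 1 k f ∎

coeff-scale : ∀ c x v → coeff (scale c x) v ≡ c * coeff x v
coeff-scale c x v = trans (coeff-pair (scale c x) v) (trans (pair-scale c x (χ v)) (cong (c *_) (sym (coeff-pair x v))))

coeff-𝔖-zerosThen : ∀ n k v → suc n ≤ k → coeff (𝔖 (zerosThen k n)) v ≡ negOnePow n * ribbonAt n 1 k (χ v)
coeff-𝔖-zerosThen n k v n<k = begin
  coeff (𝔖 (zerosThen k n)) v
    ≡⟨ coeff-pair (𝔖 (zerosThen k n)) v ⟩
  pair (𝔖 (zerosThen k n)) (χ v)
    ≡⟨ pair-𝔖 (zerosThen k n) (χ v) ⟩
  det (length (zerosThen k n)) (letterMatrix (𝔖-letter (zerosThen k n))) (χ v)
    ≡⟨ cong (λ m → det m (letterMatrix (𝔖-letter (zerosThen k n))) (χ v)) (length-zerosThen k n) ⟩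
  det (suc n) (letterMatrix (𝔖-letter (zerosThen k n))) (χ v)
    ≡⟨ det-𝔖-zerosThen n k (χ v) (χ-regular v) n<k ⟩
  negOnePow n * ribbonAt n 1 k (χ v) ∎

coeff-R-hook : ∀ n k v → suc n ≤ k → coeff (R (hook n k)) v ≡ ribbonAt n 1 k (χ v)
coeff-R-hook n k v n<k = trans (coeff-pair (R (hook n k)) v) (pair-R-hook n k (χ v) n<k)

coeff-sum-𝔖 : ∀ n k v → suc n ≤ k →
  coeff (sumN (map (λ β → 𝔖 (map +_ β)) (filterᵇ (λ β → ⌊ length β ℕ.≟ suc n ⌋) (compositions k)))) v ≡ ribbonAt n 1 k (χ v)
coeff-sum-𝔖 n k v n<k = begin
  coeff (sumN (map 𝔖⁺ F)) v                     ≡⟨ coeff-pair (sumN (map 𝔖⁺ F)) v ⟩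
  pair (sumN (map 𝔖⁺ F)) (χ v)                  ≡⟨ pair-sumN (map 𝔖⁺ F) (χ v) ⟩
  sumOver (map 𝔖⁺ F) (λ x → pair x (χ v))       ≡⟨ sumOver-map 𝔖⁺ F (λ x → pair x (χ v)) ⟩
  sumOver F (λ β → pair (𝔖⁺ β) (χ v))           ≡⟨ sum-𝔖-compositions n k (sumℕ v) (χ v) (χ-regular v) (χ-homogeneous v) n<k ⟩
  ribbonAt n 1 k (χ v)                          ∎
  where
  𝔖⁺ : List ℕ → NSym
  𝔖⁺ β = 𝔖 (map +_ β)
  F = filterᵇ (λ β → ⌊ length β ℕ.≟ suc n ⌋) (compositions k)

lemma5p4 : (k j : ℕ) → 0 < k → 1 ≤ j → j ≤ k →
  (𝔖 (replicate (j ∸ 1) (+ 0) ++ (+ k ∷ []))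
     ≈ scale (negOnePow (j ℕ.+ 1)) (R (replicate (j ∸ 1) 1 ++ ((k ∸ j) ℕ.+ 1 ∷ []))))
  × (scale (negOnePow (j ℕ.+ 1)) (R (replicate (j ∸ 1) 1 ++ ((k ∸ j) ℕ.+ 1 ∷ [])))
     ≈ scale (negOnePow (j ℕ.+ 1))
         (sumN (map (λ β → 𝔖 (map +_ β))
                    (filterᵇ (λ β → ⌊ length β ℕ.≟ j ⌋) (compositions k)))))
lemma5p4 k (suc n) _ _ n<k = 𝔖≈ribbon , ribbon≈sum
  where
  s = negOnePow (suc n ℕ.+ 1)
  sum𝔖 = sumN (map (λ β → 𝔖 (map +_ β)) (filterᵇ (λ β → ⌊ length β ℕ.≟ suc n ⌋) (compositions k)))
  𝔖≈ribbon : 𝔖 (zerosThen k n) ≈ scale s (R (hook n k))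
  𝔖≈ribbon v = begin
    coeff (𝔖 (zerosThen k n)) v          ≡⟨ coeff-𝔖-zerosThen n k v n<k ⟩
    negOnePow n * ribbonAt n 1 k (χ v)   ≡⟨ cong₂ _*_ (trans (cong negOnePow (ℕ.+-comm (suc n) 1)) (⁻¹-involutive (negOnePow n)))
                                                      (coeff-R-hook n k v n<k) ⟨
    s * coeff (R (hook n k)) v           ≡⟨ coeff-scale s (R (hook n k)) v ⟨
    coeff (scale s (R (hook n k))) v     ∎
  ribbon≈sum : scale s (R (hook n k)) ≈ scale s sum𝔖
  ribbon≈sum v = begin
    coeff (scale s (R (hook n k))) v     ≡⟨ coeff-scale s (R (hook n k)) v ⟩
    s * coeff (R (hook n k)) v           ≡⟨ cong (s *_) (trans (coeff-R-hook n k v n<k) (sym (coeff-sum-𝔖 n k v n<k))) ⟩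
    s * coeff sum𝔖 v                     ≡⟨ coeff-scale s sum𝔖 v ⟨
    coeff (scale s sum𝔖) v               ∎
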